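{- For the blossomed $n$-cycle $H_n$ with its cyclic ample framing, the fan $\mathsf{DKK}_{\mathrm{red}}(H_n)$ is combinatorially isomorphic to the normal fan of the cyclohedron.
   Context: The blossomed $n$-cycle is the directed $n$-cycle $1\to2\to\dots\to n\to1$ together with, for each cycle vertex $i$, a new source with an edge into $i$ and a new sink with an edge out of $i$; its cyclic ample framing colours the cycle edges red and the other edges blue. Routes: the cycle and directed source-to-sink walks; good routes are $\rho_{(a,b)}$ ($a,b\in[n]$): enter the cycle at $a$, follow it until first reaching $b$, and exit. Two routes $\rho,\rho'$ are incompatible if both are source-to-sink walks and there is a common subwalk $S$ (possibly a vertex) with $\rho=PSQ$, $\rho'=P'SQ'$, last edge of $P$ and first edge of $Q'$ blue, first edge of $Q$ and last edge of $P'$ red; exceptional routes are those compatible with every route. $\mathsf{DKK}(H_n)$ is the complete fan in the flow cone whose cones are spanned by indicator vectors of sets of pairwise compatible routes among the cycle and the good routes, and $\mathsf{DKK}_{\mathrm{red}}(H_n)$ is its projection to the quotient of the balanced flow space by the span of indicator vectors of exceptional routes. The cyclohedron is the polytope whose normal fan has rays indexed by pairs of centrally symmetric diagonals of a regular $2n$-gon (a diameter counting as one such pair), a set of rays spanning a cone iff the corresponding diagonals are pairwise noncrossing in the interior. -}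

module Defs where

open import Data.Nat as ℕ using (ℕ; zero; suc; _+_; _∸_; _<_; _≤_; NonZero; _<ᵇ_; _⊓_; _⊔_)
import Data.Nat.Properties
open import Data.Nat.DivMod using (_mod_)
open import Data.Fin as Fin using (Fin; toℕ)
open import Data.List using (List; []; _∷_; _++_; length; lookup; map; filter)
open import Data.List.Relation.Unary.All using (All)
open import Data.List.Relation.Unary.AllPairs using (AllPairs)
open import Data.List.Membership.Propositional using (_∈_)
open import Data.Bool using (if_then_else_)
open import Data.Product using (Σ; ∃; _×_; _,_; proj₁; proj₂)
open import Data.Sum using (_⊎_)
open import Data.Empty using (⊥)
open import Data.Unit using (⊤)
open import Relation.Nullary using (¬_; Dec; yes; no)
open import Relation.Binary.PropositionalEquality using (_≡_; _≢_; refl; cong)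
open import Data.Rational as ℚ using (ℚ; 0ℚ)
import Data.Rational.Properties
open import Data.List.Base using (allFin)

-- Cycle vertices are Fin n (0-based: vertex i of the paper is i-1),
-- cycle edge  cyc i : i → i ⊕ 1,
-- in-edge     inE i : src i → i,
-- out-edge    outE i : i → snk i.

data Vertex (n : ℕ) : Set where
  cv src snk : Fin n → Vertex n

data Edge (n : ℕ) : Set where
  cyc inE outE : Fin n → Edge n

data Colour : Set where
  red blue : Colour

colour : ∀ {n} → Edge n → Colour
colour (cyc _)  = red
colour (inE _)  = blue
colour (outE _) = blue

module _ (n : ℕ) .{{_ : NonZero n}} where

  _⊕_ : Fin n → ℕ → Fin n
  i ⊕ k = (toℕ i + k) mod n

  target : Edge n → Vertex n
  target (cyc i)  = cv (i ⊕ 1)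
  target (inE i)  = cv i
  target (outE i) = snk i

  cycPath : Fin n → ℕ → List (Edge n)
  cycPath a zero    = []
  cycPath a (suc k) = cyc a ∷ cycPath (a ⊕ 1) k

-- Every directed
-- source-to-sink walk of H_n is  src a → a → a⊕1 → … → a⊕k → snk (a⊕k)
-- for unique a : Fin n and k : ℕ (k may exceed n: walks may wind around).
data Route (n : ℕ) : Set where
  cycle : Route n
  walk  : Fin n → ℕ → Route n

edgesOf : ∀ n .{{_ : NonZero n}} → Route n → List (Edge n)
edgesOf n cycle      = map cyc (allFin n)
edgesOf n (walk a k) = inE a ∷ (cycPath n a k ++ outE (_⊕_ n a k) ∷ [])

-- ρ = P S Q and ρ' = P' S Q' with S a common subwalk (given by its
-- starting vertex v and its edge list es, es = [] meaning S is the
-- vertex v), last edge e of P and first edge f' of Q' blue, first edge f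
-- of Q and last edge e' of P' red.
IncompatibleAt : ∀ n .{{_ : NonZero n}} → Route n → Route n → Set
IncompatibleAt n ρ ρ' =
  ∃ λ (v : Vertex n) → ∃ λ (es : List (Edge n)) →
  ∃ λ (P₀ : List (Edge n)) → ∃ λ (e : Edge n) → ∃ λ (f : Edge n) → ∃ λ (Q₀ : List (Edge n)) →
  ∃ λ (P₀' : List (Edge n)) → ∃ λ (e' : Edge n) → ∃ λ (f' : Edge n) → ∃ λ (Q₀' : List (Edge n)) →
    edgesOf n ρ  ≡ P₀  ++ e  ∷ (es ++ f  ∷ Q₀)  ×
    edgesOf n ρ' ≡ P₀' ++ e' ∷ (es ++ f' ∷ Q₀') ×
    target n e ≡ v × target n e' ≡ v ×
    colour e ≡ blue × colour f' ≡ blue ×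
    colour f ≡ red × colour e' ≡ red

IsWalk : ∀ {n} → Route n → Set
IsWalk cycle      = ⊥
IsWalk (walk _ _) = ⊤

Incompatible : ∀ n .{{_ : NonZero n}} → Route n → Route n → Set
Incompatible n ρ ρ' =
  IsWalk ρ × IsWalk ρ' × (IncompatibleAt n ρ ρ' ⊎ IncompatibleAt n ρ' ρ)

Compatible : ∀ n .{{_ : NonZero n}} → Route n → Route n → Set
Compatible n ρ ρ' = ¬ Incompatible n ρ ρ'

Exceptional : ∀ n .{{_ : NonZero n}} → Route n → Set
Exceptional n ρ = ∀ ρ' → Compatible n ρ ρ'

IsGoodRoute : ∀ n .{{_ : NonZero n}} → Fin n → Fin n → Route n → Set
IsGoodRoute n a b ρ =
  ∃ λ k → ρ ≡ walk a k × _⊕_ n a k ≡ b × (∀ j → j < k → _⊕_ n a j ≢ b)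

Good : ∀ n .{{_ : NonZero n}} → Route n → Set
Good n ρ = ∃ λ a → ∃ λ b → IsGoodRoute n a b ρ

record CompatSet (n : ℕ) .{{_ : NonZero n}} : Set where
  constructor compatSet
  field
    routes   : List (Route n)
    allowed  : All (λ ρ → ρ ≡ cycle ⊎ Good n ρ) routes
    pairwise : AllPairs (Compatible n) routes
open CompatSet public

_≟E_ : ∀ {n} → (e f : Edge n) → Dec (e ≡ f)
cyc i  ≟E cyc j  with i Fin.≟ j
... | yes refl = yes refl
... | no ne    = no λ { refl → ne refl }
inE i  ≟E inE j  with i Fin.≟ j
... | yes refl = yes refl
... | no ne    = no λ { refl → ne refl }
outE i ≟E outE j with i Fin.≟ j
... | yes refl = yes refl
... | no ne    = no λ { refl → ne refl }
cyc _  ≟E inE _  = no λ ()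
cyc _  ≟E outE _ = no λ ()
inE _  ≟E cyc _  = no λ ()
inE _  ≟E outE _ = no λ ()
outE _ ≟E cyc _  = no λ ()
outE _ ≟E inE _  = no λ ()

Flow : ℕ → Set
Flow n = Edge n → ℚ

indicator : ∀ n .{{_ : NonZero n}} → Route n → Flow n
indicator n ρ e = (ℤ.+ length (filter (e ≟E_) (edgesOf n ρ))) ℚ./ 1
  where import Data.Integer as ℤ

sumℚ : ∀ {k} → (Fin k → ℚ) → ℚ
sumℚ {zero}  g = 0ℚ
sumℚ {suc k} g = g Fin.zero ℚ.+ sumℚ (λ i → g (Fin.suc i))

-- x (a flow in the balanced flow space) lies in the preimage under the
-- quotient map (by span of exceptional indicator vectors) of the
-- projected cone spanned by the routes of C:
--   x = Σ λ_ρ 1_ρ (λ ≥ 0, ρ ∈ C) + Σ μ_τ 1_τ (τ exceptional, μ arbitrary)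
InRedCone : ∀ n .{{_ : NonZero n}} → List (Route n) → Flow n → Set
InRedCone n C x =
  ∃ λ (lam : Fin (length C) → ℚ) → (∀ i → 0ℚ ℚ.≤ lam i) ×
  ∃ λ (Es : List (Route n)) → All (Exceptional n) Es ×
  ∃ λ (mu : Fin (length Es) → ℚ) →
    ∀ e → x e ≡ sumℚ (λ i → lam i ℚ.* indicator n (lookup C i) e)
                ℚ.+ sumℚ (λ j → mu j ℚ.* indicator n (lookup Es j) e)

-- inclusion of cones of DKK_red(H_n) (subsets of the quotient space are
-- compared via their saturated preimages)
RedConeSub : ∀ n .{{_ : NonZero n}} → CompatSet n → CompatSet n → Set
RedConeSub n C C' = ∀ x → InRedCone n (routes C) x → InRedCone n (routes C') x

IsDiag : ℕ → ℕ × ℕ → Set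
IsDiag n (i , j) = suc i < j × j < 2 ℕ.* n × ¬ (i ≡ 0 × suc j ≡ 2 ℕ.* n)

Diag : ℕ → Set
Diag n = Σ (ℕ × ℕ) (IsDiag n)

antipode : ℕ → ℕ → ℕ
antipode n k = if k <ᵇ n then k + n else k ∸ n

SameSeg : ℕ × ℕ → ℕ × ℕ → Set
SameSeg (i , j) (k , l) = (i ≡ k × j ≡ l) ⊎ (i ≡ l × j ≡ k)

antiSeg : ℕ → ℕ × ℕ → ℕ × ℕ
antiSeg n (i , j) = (antipode n i , antipode n j)

Cross : ℕ × ℕ → ℕ × ℕ → Set
Cross (a , b) (c , d) =
  (i < k × k < j × j < l) ⊎ (k < i × i < l × l < j)
  where i = a ⊓ b ; j = a ⊔ b ; k = c ⊓ d ; l = c ⊔ d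

-- a ray of the cyclohedron fan is a pair {D, antipodal D} of centrally
-- symmetric diagonals (a diameter being its own pair), represented by D
InRay : ∀ n → ℕ × ℕ → Diag n → Set
InRay n d D = SameSeg d (proj₁ D) ⊎ SameSeg d (antiSeg n (proj₁ D))

SameRay : ∀ n → Diag n → Diag n → Set
SameRay n D D' = InRay n (proj₁ D) D'

-- a finite set of rays spans a cone iff all its diagonals are pairwise
-- noncrossing in the interior
NoncrossingRays : ∀ n → List (Diag n) → Set
NoncrossingRays n S =
  ∀ D D' → D ∈ S → D' ∈ S → ∀ d d' → InRay n d D → InRay n d' D' → ¬ Cross d d'

RaySub : ∀ n → List (Diag n) → List (Diag n) → Set
RaySub n S S' = ∀ D → D ∈ S → ∃ λ D' → D' ∈ S' × SameRay n D D'

{-# OPTIONS --safe #-}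
module Submission where

-- A route entering the cycle at a and following it for 0 < k < n steps is sent to the ray of
-- the diagonal from a to a + k + 1 of the 2n-gon; the cycle and the trivial routes are
-- exceptional and give no ray, and every ray comes from exactly one route.  Two routes are
-- incompatible exactly when one enters the cycle strictly inside the other (up to a full turn),
-- runs along it and leaves it first; on the 2n-gon, which unwinds the n-cycle twice, this says
-- that the diagonal of one interleaves the diagonal of the other or its antipode.
-- Cone inclusion is read off the routes: the source-minus-sink balance at a vertex vanishes on
-- exceptional routes and is 1 at the entry and -1 at the exit of a route.  So when the indicator
-- of ρ_(a,b) lies in the cone of a compatible set C', some route of C' entering at a has positive
-- weight, no route of C' enters where that route exits (the two would be incompatible), and the
-- balance at its exit forces that exit to be b.

open import Defs
open import Data.Bool using (true; false)
open import Data.Fin as Fin using (Fin; toℕ; fromℕ<)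
open import Data.Fin.Properties using (toℕ<n; toℕ-injective; toℕ-fromℕ<)
import Data.Integer as ℤ
open import Data.List using (List; []; _∷_; _++_; length; concatMap; map; lookup; filter; allFin)
open import Data.List.Membership.Propositional using (_∈_; find; lose)
open import Data.List.Membership.Propositional.Properties
  using (∈-AllPairs₂; ∈-concatMap⁺; ∈-concatMap⁻; ∈-map⁺; ∈-map⁻; ∈-lookup)
open import Data.List.Properties
  using (∷-injective; ∷-injectiveˡ; ∷-injectiveʳ; ++-conicalʳ; ++-assoc
        ; filter-accept; filter-reject; filter-none; filter-++)
open import Data.List.Relation.Unary.All as All using (All; []; _∷_)
import Data.List.Relation.Unary.All.Properties as All
open import Data.List.Relation.Unary.AllPairs using (AllPairs; []; _∷_)
import Data.List.Relation.Unary.AllPairs.Properties as AllPairs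
open import Data.List.Relation.Unary.Any as Any using (here; there)
open import Data.List.Relation.Unary.Any.Properties using (lookup-index)
open import Data.Nat as ℕ
  using (ℕ; NonZero; zero; suc; _+_; _*_; _∸_; _<_; _≤_; _⊓_; _⊔_; _<ᵇ_; _<?_
        ; s≤s; s≤s⁻¹; z<s; s<s; >-nonZero⁻¹)
open import Data.Nat.DivMod using (_%_; m<n⇒m%n≡m; [m+n]%n≡m%n; %-distribˡ-+; m%n%n≡m%n)
open import Data.Nat.Properties
open import Data.Nat.Tactic.RingSolver using (solve-∀)
open import Data.Product as Product using (∃; _×_; _,_; proj₁; proj₂)
open import Data.Rational as ℚ using (ℚ; 0ℚ; 1ℚ)
import Data.Rational.Properties as ℚ
open import Data.Rational.Solver using (module +-*-Solver)
open import Data.Sum using (_⊎_; inj₁; inj₂; swap; [_,_])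
open import Data.Unit using (tt)
open import Data.Vec.Functional as Vec using (updateAt)
open import Data.Vec.Functional.Properties using (updateAt-updates; updateAt-minimal)
open import Function using (id; _∘_)
open import Function.Bundles using (_⇔_; mk⇔; Equivalence)
open import Relation.Binary.PropositionalEquality
  using (_≡_; _≢_; refl; sym; trans; cong; cong₂; subst; subst₂; module ≡-Reasoning)
open import Relation.Nullary using (¬_; Dec; yes; no; contradiction; _×-dec_)
open import Relation.Nullary.Reflects using (ofʸ; ofⁿ)
open +-*-Solver using (solve; _:+_; _:*_; _:-_; _:=_)

-- Diagonals of the 2n-gon

shift : ℕ → ℕ × ℕ → ℕ × ℕ
shift N (i , j) = i + N , j + N

Staggered : ℕ × ℕ → ℕ × ℕ → Set
Staggered (i , j) (k , l) = i < k × k < j × j < l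

Crossing : ℕ × ℕ → ℕ × ℕ → Set
Crossing s t = Staggered s t ⊎ Staggered t s

normal : ℕ × ℕ → ℕ × ℕ
normal (i , j) = i ⊓ j , i ⊔ j

Cross⇔Crossing : ∀ {s t u v} → normal s ≡ u → normal t ≡ v → Cross s t ⇔ Crossing u v
Cross⇔Crossing refl refl = mk⇔ id id

normal-ordered : ∀ {i j} → i ≤ j → normal (i , j) ≡ (i , j)
normal-ordered i≤j rewrite m≤n⇒m⊓n≡m i≤j | m≤n⇒m⊔n≡n i≤j = refl

normal-swap : ∀ i j → normal (j , i) ≡ normal (i , j)
normal-swap i j rewrite ⊓-comm i j | ⊔-comm i j = refl

SameSeg⇒normal≡ : ∀ {s t} → SameSeg s t → normal s ≡ normal t
SameSeg⇒normal≡ (inj₁ (refl , refl)) = refl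
SameSeg⇒normal≡ {i , j} (inj₂ (refl , refl)) = normal-swap j i

Cross-resp : ∀ {s s′ t t′} → SameSeg s s′ → SameSeg t t′ → Cross s t → Cross s′ t′
Cross-resp s≈ t≈ = Equivalence.from (Cross⇔Crossing (sym (SameSeg⇒normal≡ s≈)) (sym (SameSeg⇒normal≡ t≈)))

Cross-sym : ∀ {s t} → Cross s t → Cross t s
Cross-sym (inj₁ st) = inj₂ st
Cross-sym (inj₂ ts) = inj₁ ts

antipode-< : ∀ {N x} → x < N → antipode N x ≡ x + N
antipode-< {N} {x} x<N with x <ᵇ N | <ᵇ-reflects-< x N
... | true  | _        = refl
... | false | ofⁿ x≮N = contradiction x<N x≮N

antipode-+ : ∀ N x → antipode N (x + N) ≡ x
antipode-+ N x with x + N <ᵇ N | <ᵇ-reflects-< (x + N) N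
... | true  | ofʸ x+N<N = contradiction x+N<N (m+n≮n x N)
... | false | _          = m+n∸n≡m x N

data AntiShape (N A B : ℕ) : Set where
  unwrapped : B < N → normal (antiSeg N (A , B)) ≡ shift N (A , B) → AntiShape N A B
  wrapped   : ∀ B′ → B′ < N → B ≡ B′ + N → normal (antiSeg N (A , B)) ≡ (B′ , A + N) → AntiShape N A B

antiShape : ∀ {N A B} → A < N → A ≤ B → B < N + N → AntiShape N A B
antiShape {N} {A} {B} A<N A≤B B<2N with B <? N
... | yes B<N = unwrapped B<N (begin
  normal (antiSeg N (A , B))  ≡⟨ cong normal (cong₂ _,_ (antipode-< A<N) (antipode-< B<N)) ⟩
  normal (A + N , B + N)      ≡⟨ normal-ordered (+-monoˡ-≤ N A≤B) ⟩
  shift N (A , B)             ∎)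
  where open ≡-Reasoning
... | no B≮N = wrapped B′ B′<N (sym B′+N≡B) (begin
  normal (antiSeg N (A , B))  ≡⟨ cong normal (cong₂ _,_ (antipode-< A<N) B̄≡B′) ⟩
  normal (A + N , B′)         ≡⟨ normal-swap B′ (A + N) ⟩
  normal (B′ , A + N)         ≡⟨ normal-ordered (<⇒≤ (<-≤-trans B′<N (m≤n+m N A))) ⟩
  (B′ , A + N)                ∎)
  where
    open ≡-Reasoning
    B′ = B ∸ N
    B′+N≡B : B′ + N ≡ B
    B′+N≡B = m∸n+n≡m (≮⇒≥ B≮N)
    B′<N : B′ < N
    B′<N = +-cancelʳ-< N B′ N (subst (_< N + N) (sym B′+N≡B) B<2N)
    B̄≡B′ : antipode N B ≡ B′
    B̄≡B′ = trans (cong (antipode N) (sym B′+N≡B)) (antipode-+ N B′)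

chord : ℕ → ℕ → ℕ × ℕ
chord A k = A , suc (A + k)

ProperChord : ℕ → ℕ → ℕ → Set
ProperChord N A k = A < N × 0 < k × k < N

normal-chord : ∀ A k → normal (chord A k) ≡ chord A k
normal-chord A k = normal-ordered (m≤n⇒m≤1+n (m≤m+n A k))

chord-end< : ∀ {N A k} → ProperChord N A k → suc (A + k) < N + N
chord-end< (A<N , _ , k<N) = +-mono-≤-< A<N k<N

chord-end≤ : ∀ {N} A {k} → k < N → suc (A + k) ≤ A + N
chord-end≤ {N} A {k} k<N = subst (_≤ A + N) (+-suc A k) (+-monoʳ-≤ A k<N)

antiChordShape : ∀ {N A k} → ProperChord N A k → AntiShape N A (suc (A + k))
antiChordShape {A = A} {k} p@(A<N , _ , _) = antiShape A<N (m≤n⇒m≤1+n (m≤m+n A k)) (chord-end< p)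

-- The route of length l entering the cycle at C runs into the route of length k entering at A
-- (read modulo N) and leaves the cycle before it.
Overlap : ℕ → ℕ → ℕ → ℕ → ℕ → Set
Overlap N A k C l = Staggered (chord C l) (chord A k) ⊎ Staggered (chord C l) (shift N (chord A k))

Overlapping : ℕ → ℕ → ℕ → ℕ → ℕ → Set
Overlapping N A k C l = Overlap N A k C l ⊎ Overlap N C l A k

chords-cross⇒overlapping : ∀ {N A k C l} → Cross (chord A k) (chord C l) → Overlapping N A k C l
chords-cross⇒overlapping {A = A} {k} {C} {l} x with Equivalence.to (Cross⇔Crossing (normal-chord A k) (normal-chord C l)) x
... | inj₁ ac = inj₂ (inj₁ ac)
... | inj₂ ca = inj₁ (inj₁ ca)

chord-antichord-cross⇒overlapping : ∀ {N A k C l} → ProperChord N A k → ProperChord N C l →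
                        Cross (chord A k) (antiSeg N (chord C l)) → Overlapping N A k C l
chord-antichord-cross⇒overlapping {N} {A} {k} {C} {l} pa@(A<N , _ , k<N) pc@(C<N , _ , _) x with antiChordShape pc
... | unwrapped _ eq with Equivalence.to (Cross⇔Crossing (normal-chord A k) eq) x
...   | inj₁ ac = inj₂ (inj₂ ac)
...   | inj₂ (C+N<A , _) = contradiction (<-trans C+N<A A<N) (m+n≮n C N)
chord-antichord-cross⇒overlapping {N} {A} {k} {C} {l} pa@(A<N , _ , k<N) pc@(C<N , _ , _) x
    | wrapped E′ _ E≡ eq with Equivalence.to (Cross⇔Crossing (normal-chord A k) eq) x
...   | inj₁ (A<E′ , E′<B , _) =
  inj₁ (inj₂ (<-≤-trans C<N (m≤n+m N A) , subst (A + N <_) (sym E≡) (+-monoˡ-< N A<E′) ,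
              subst (_< suc (A + k) + N) (sym E≡) (+-monoˡ-< N E′<B)))
...   | inj₂ (_ , A<C+N , C+N<B) =
  inj₂ (inj₂ (A<C+N , C+N<B , <-≤-trans (chord-end< pa) (+-monoˡ-≤ N (subst (N ≤_) (sym E≡) (m≤n+m N E′)))))

Crossing-sym : ∀ {s t} → Crossing s t → Crossing t s
Crossing-sym (inj₁ st) = inj₂ st
Crossing-sym (inj₂ ts) = inj₁ ts

Staggered-shift⁻ : ∀ {N} s t → Staggered (shift N s) (shift N t) → Staggered s t
Staggered-shift⁻ {N} (i , j) (k , l) (x , y , z) = +-cancelʳ-< N i k x , +-cancelʳ-< N k j y , +-cancelʳ-< N j l z

Crossing-shift⁻ : ∀ {N} s t → Crossing (shift N s) (shift N t) → Crossing s t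
Crossing-shift⁻ s t (inj₁ st) = inj₁ (Staggered-shift⁻ s t st)
Crossing-shift⁻ s t (inj₂ ts) = inj₂ (Staggered-shift⁻ t s ts)

Crossing-unwrapped-wrapped⁻ : ∀ {N A B C E E′} → B < N → E′ < N → E ≡ E′ + N →
                              Crossing (shift N (A , B)) (E′ , C + N) → Crossing (A , B) (C , E)
Crossing-unwrapped-wrapped⁻ {N} {A} B<N E′<N E≡ (inj₁ (A+N<E′ , _)) = contradiction (<-trans A+N<E′ E′<N) (m+n≮n A N)
Crossing-unwrapped-wrapped⁻ {N} {A} {B} {C} {E} {E′} B<N E′<N E≡ (inj₂ (_ , A+N<C+N , C+N<B+N)) =
  inj₁ (+-cancelʳ-< N A C A+N<C+N , +-cancelʳ-< N C B C+N<B+N , <-≤-trans B<N (subst (N ≤_) (sym E≡) (m≤n+m N E′)))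

Staggered-wrapped⁻ : ∀ {N A B B′ C E E′} → C < N → B ≡ B′ + N → E ≡ E′ + N →
                     Staggered (B′ , A + N) (E′ , C + N) → Staggered (A , B) (C , E)
Staggered-wrapped⁻ {N} {A} {B} {B′} {C} {E} {E′} C<N B≡ E≡ (B′<E′ , _ , A+N<C+N) =
  +-cancelʳ-< N A C A+N<C+N , <-≤-trans C<N (subst (N ≤_) (sym B≡) (m≤n+m N B′)) ,
  subst₂ _<_ (sym B≡) (sym E≡) (+-monoˡ-< N B′<E′)

Cross-antichords⁻ : ∀ {N A k C l} → ProperChord N A k → ProperChord N C l →
                    Cross (antiSeg N (chord A k)) (antiSeg N (chord C l)) → Cross (chord A k) (chord C l)
Cross-antichords⁻ {N} {A} {k} {C} {l} pa@(A<N , _) pc@(C<N , _) x =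
  Equivalence.from (Cross⇔Crossing (normal-chord A k) (normal-chord C l)) (crossing (antiChordShape pa) (antiChordShape pc))
  where
    crossing : AntiShape N A (suc (A + k)) → AntiShape N C (suc (C + l)) → Crossing (chord A k) (chord C l)
    crossing (unwrapped _ eqa) (unwrapped _ eqc) =
      Crossing-shift⁻ (chord A k) (chord C l) (Equivalence.to (Cross⇔Crossing eqa eqc) x)
    crossing (unwrapped B<N eqa) (wrapped E′ E′<N E≡ eqc) =
      Crossing-unwrapped-wrapped⁻ B<N E′<N E≡ (Equivalence.to (Cross⇔Crossing eqa eqc) x)
    crossing (wrapped B′ B′<N B≡ eqa) (unwrapped E<N eqc) =
      Crossing-sym (Crossing-unwrapped-wrapped⁻ E<N B′<N B≡ (Crossing-sym (Equivalence.to (Cross⇔Crossing eqa eqc) x)))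
    crossing (wrapped B′ _ B≡ eqa) (wrapped E′ _ E≡ eqc) with Equivalence.to (Cross⇔Crossing eqa eqc) x
    ... | inj₁ st = inj₁ (Staggered-wrapped⁻ C<N B≡ E≡ st)
    ... | inj₂ ts = inj₂ (Staggered-wrapped⁻ A<N E≡ B≡ ts)

InRaySeg : ℕ → ℕ × ℕ → ℕ × ℕ → Set
InRaySeg N d s = SameSeg d s ⊎ SameSeg d (antiSeg N s)

crossing-rays⇒overlapping : ∀ {N A k C l d d′} → ProperChord N A k → ProperChord N C l →
                            InRaySeg N d (chord A k) → InRaySeg N d′ (chord C l) → Cross d d′ → Overlapping N A k C l
crossing-rays⇒overlapping pa pc (inj₁ d≈) (inj₁ d′≈) x = chords-cross⇒overlapping (Cross-resp d≈ d′≈ x)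
crossing-rays⇒overlapping pa pc (inj₁ d≈) (inj₂ d′≈) x = chord-antichord-cross⇒overlapping pa pc (Cross-resp d≈ d′≈ x)
crossing-rays⇒overlapping pa pc (inj₂ d≈) (inj₁ d′≈) x =
  swap (chord-antichord-cross⇒overlapping pc pa (Cross-sym (Cross-resp d≈ d′≈ x)))
crossing-rays⇒overlapping pa pc (inj₂ d≈) (inj₂ d′≈) x =
  chords-cross⇒overlapping (Cross-antichords⁻ pa pc (Cross-resp d≈ d′≈ x))

overlap⇒cross : ∀ {N A k C l} → ProperChord N A k → ProperChord N C l → Overlap N A k C l →
                Cross (chord C l) (chord A k) ⊎ Cross (antiSeg N (chord C l)) (chord A k)
overlap⇒cross {A = A} {k} {C} {l} pa pc (inj₁ ca) =
  inj₁ (Equivalence.from (Cross⇔Crossing (normal-chord C l) (normal-chord A k)) (inj₁ ca))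
overlap⇒cross {N} {A} {k} {C} {l} pa@(A<N , _ , k<N) pc@(_ , _ , l<N) (inj₂ (_ , A+N<E , E<B+N)) with antiChordShape pc
... | unwrapped E<N _ = contradiction (<-trans A+N<E E<N) (m+n≮n A N)
... | wrapped E′ _ E≡ eq =
  inj₂ (Equivalence.from (Cross⇔Crossing eq (normal-chord A k))
         (inj₂ (+-cancelʳ-< N A E′ (subst (A + N <_) E≡ A+N<E) ,
                +-cancelʳ-< N E′ (suc (A + k)) (subst (_< suc (A + k) + N) E≡ E<B+N) ,
                ≤-<-trans (chord-end≤ A k<N) (<-≤-trans A+N<E (chord-end≤ C l<N)))))

chord-injective : ∀ {A k C l} → chord A k ≡ chord C l → A ≡ C × k ≡ l
chord-injective {A} {k} {C} {l} eq =
  A≡C , +-cancelˡ-≡ A k l (suc-injective (trans (cong proj₂ eq) (cong (λ x → suc (x + l)) (sym A≡C))))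
  where
    A≡C : A ≡ C
    A≡C = cong proj₁ eq

chord-ray-injective : ∀ {N A k C l} → ProperChord N A k → ProperChord N C l →
                      InRaySeg N (chord A k) (chord C l) → A ≡ C × k ≡ l
chord-ray-injective {A = A} {k} {C} {l} _ _ (inj₁ s) =
  chord-injective (trans (sym (normal-chord A k)) (trans (SameSeg⇒normal≡ s) (normal-chord C l)))
chord-ray-injective {N} {A} {k} {C} {l} (A<N , _ , k<N) pc@(_ , _ , l<N) (inj₂ s) with antiChordShape pc
... | unwrapped _ eq = contradiction (subst (_< N) (cong proj₁ chord≡) A<N) (m+n≮n C N)
  where
    chord≡ : chord A k ≡ shift N (chord C l)
    chord≡ = trans (sym (normal-chord A k)) (trans (SameSeg⇒normal≡ s) eq)
... | wrapped E′ _ E≡ eq = A≡C , +-cancelˡ-≡ A k l (suc-injective (+-cancelʳ-≡ N _ _ B+N≡E+N))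
  where
    chord≡ : chord A k ≡ (E′ , C + N)
    chord≡ = trans (sym (normal-chord A k)) (trans (SameSeg⇒normal≡ s) eq)
    A+N≡E : A + N ≡ suc (C + l)
    A+N≡E = trans (cong (_+ N) (cong proj₁ chord≡)) (sym E≡)
    B≡C+N : suc (A + k) ≡ C + N
    B≡C+N = cong proj₂ chord≡
    A≡C : A ≡ C
    A≡C = ≤-antisym (+-cancelʳ-≤ N A C (subst (_≤ C + N) (sym A+N≡E) (chord-end≤ C l<N)))
                    (+-cancelʳ-≤ N C A (subst (_≤ A + N) B≡C+N (chord-end≤ A k<N)))
    B+N≡E+N : suc (A + k) + N ≡ suc (A + l) + N
    B+N≡E+N = begin
      suc (A + k) + N  ≡⟨ cong (_+ N) B≡C+N ⟩
      C + N + N        ≡⟨ cong (λ x → x + N + N) (sym A≡C) ⟩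
      A + N + N        ≡⟨ cong (_+ N) A+N≡E ⟩
      suc (C + l) + N  ≡⟨ cong (λ x → suc (x + l) + N) (sym A≡C) ⟩
      suc (A + l) + N  ∎
      where open ≡-Reasoning

2*N≡N+N : ∀ N → 2 * N ≡ N + N
2*N≡N+N N = cong (N +_) (+-identityʳ N)

chord-isDiag : ∀ {N A k} → ProperChord N A k → IsDiag N (chord A k)
chord-isDiag {N} {A} {k} p@(_ , 0<k , k<N) = s<s (m<m+n A 0<k) , subst (suc (A + k) <_) (sym (2*N≡N+N N)) (chord-end< p) , not-edge
  where
    not-edge : ¬ (A ≡ 0 × suc (suc (A + k)) ≡ 2 * N)
    not-edge (refl , e) = <-irrefl refl (<-≤-trans 0<k (s≤s⁻¹ (<-≤-trans k<N N≤1)))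
      where
        N≤1 : N ≤ 1
        N≤1 = +-cancelʳ-≤ N N 1 (subst (_≤ suc N) (trans e (2*N≡N+N N)) (s≤s k<N))

-- Both antipodal relations are recorded because antiSeg is an involution only on segments of the 2N-gon.
SameRaySeg : ℕ → ℕ × ℕ → ℕ × ℕ → Set
SameRaySeg N d s = SameSeg d s ⊎ (SameSeg d (antiSeg N s) × SameSeg s (antiSeg N d))

SameSeg-sym : ∀ {s t} → SameSeg s t → SameSeg t s
SameSeg-sym (inj₁ (refl , refl)) = inj₁ (refl , refl)
SameSeg-sym (inj₂ (refl , refl)) = inj₂ (refl , refl)

SameSeg-reflexive : ∀ {s t} → s ≡ t → SameSeg s t
SameSeg-reflexive refl = inj₁ (refl , refl)

SameSeg-antiSeg : ∀ {N s t} → SameSeg s t → SameSeg (antiSeg N s) (antiSeg N t)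
SameSeg-antiSeg (inj₁ (refl , refl)) = inj₁ (refl , refl)
SameSeg-antiSeg (inj₂ (refl , refl)) = inj₂ (refl , refl)

SameRaySeg⇒InRaySeg : ∀ {N d s} → SameRaySeg N d s → InRaySeg N d s
SameRaySeg⇒InRaySeg (inj₁ d≈s)       = inj₁ d≈s
SameRaySeg⇒InRaySeg (inj₂ (d≈s̄ , _)) = inj₂ d≈s̄

SameRaySeg⇒InRaySeg˘ : ∀ {N d s} → SameRaySeg N d s → InRaySeg N s d
SameRaySeg⇒InRaySeg˘ (inj₁ d≈s)       = inj₁ (SameSeg-sym d≈s)
SameRaySeg⇒InRaySeg˘ (inj₂ (_ , s≈d̄)) = inj₂ s≈d̄

SameRaySeg⇒antiSeg-InRaySeg˘ : ∀ {N d s} → SameRaySeg N d s → InRaySeg N (antiSeg N s) d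
SameRaySeg⇒antiSeg-InRaySeg˘ {N} (inj₁ d≈s) = inj₂ (SameSeg-antiSeg {N} (SameSeg-sym d≈s))
SameRaySeg⇒antiSeg-InRaySeg˘ (inj₂ (d≈s̄ , _)) = inj₁ (SameSeg-sym d≈s̄)

RayNormalForm : ℕ → ℕ × ℕ → Set
RayNormalForm N d = ∃ λ A → ∃ λ k → ProperChord N A k × SameRaySeg N d (chord A k)

shifted-normal-form : ∀ {N} A k → 0 < k → suc (N + A + k) < 2 * N → RayNormalForm N (N + A , suc (N + A + k))
shifted-normal-form {N} A k 0<k j<2N = A , k , (A<N , 0<k , k<N) , inj₂ (s₁ , s₂)
  where
    j≡ : suc (N + A + k) ≡ suc (A + k) + N
    j≡ = rearrange N A k
      where
        rearrange : ∀ N A k → suc (N + A + k) ≡ suc (A + k) + N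
        rearrange = solve-∀
    B<N : suc (A + k) < N
    B<N = +-cancelʳ-< N _ N (subst (_< N + N) j≡ (subst (suc (N + A + k) <_) (2*N≡N+N N) j<2N))
    A<N : A < N
    A<N = ≤-<-trans (m≤n⇒m≤1+n (m≤m+n A k)) B<N
    k<N : k < N
    k<N = ≤-<-trans (m≤n⇒m≤1+n (m≤n+m k A)) B<N
    s₁ : SameSeg (N + A , suc (N + A + k)) (antiSeg N (chord A k))
    s₁ = inj₁ (trans (+-comm N A) (sym (antipode-< A<N)) , trans j≡ (sym (antipode-< B<N)))
    s₂ : SameSeg (chord A k) (antiSeg N (N + A , suc (N + A + k)))
    s₂ = inj₁ (sym (trans (cong (antipode N) (+-comm N A)) (antipode-+ N A)) ,
               sym (trans (cong (antipode N) j≡) (antipode-+ N (suc (A + k)))))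

wrapping-normal-form : ∀ {N} i k → i < N → suc (i + (N + k)) < 2 * N → ¬ (i ≡ 0 × suc (suc (i + (N + k))) ≡ 2 * N) →
                       RayNormalForm N (i , suc (i + (N + k)))
wrapping-normal-form {N} i k i<N j<2N not-edge = form (m≤n⇒∃[o]m+o≡n (k+2<N i A<N not-edge))
  where
    j≡ : suc (i + (N + k)) ≡ suc (i + k) + N
    j≡ = rearrange i N k
      where
        rearrange : ∀ i N k → suc (i + (N + k)) ≡ suc (i + k) + N
        rearrange = solve-∀
    A<N : suc (i + k) < N
    A<N = +-cancelʳ-< N _ N (subst (_< N + N) j≡ (subst (suc (i + (N + k)) <_) (2*N≡N+N N) j<2N))
    k+2<N : ∀ i → suc (i + k) < N → ¬ (i ≡ 0 × suc (suc (i + (N + k))) ≡ 2 * N) → suc (suc k) < N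
    k+2<N zero    A<N not-edge =
      ≤∧≢⇒< A<N (λ e → not-edge (refl , trans (cong (suc ∘ suc) (+-comm N k)) (trans (cong (_+ N) e) (sym (2*N≡N+N N)))))
    k+2<N (suc i) A<N _        = ≤-<-trans (s≤s (s≤s (m≤n+m k i))) A<N
    form : (∃ λ r → 3 + k + r ≡ N) → RayNormalForm N (i , suc (i + (N + k)))
    form (r , N≡) = suc (i + k) , suc r , (A<N , z<s , l<N) , inj₂ (s₁ , s₂)
      where
        l<N : suc r < N
        l<N = subst (suc r <_) N≡ (s≤s (s≤s (m≤n⇒m≤1+n (m≤n+m r k))))
        end≡ : suc (suc (i + k) + suc r) ≡ i + N
        end≡ = trans (rearrange i k r) (cong (i +_) N≡)
          where
            rearrange : ∀ i k r → suc (suc (i + k) + suc r) ≡ i + (3 + k + r)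
            rearrange = solve-∀
        s₁ : SameSeg (i , suc (i + (N + k))) (antiSeg N (chord (suc (i + k)) (suc r)))
        s₁ = inj₂ (sym (trans (cong (antipode N) end≡) (antipode-+ N i)) , trans j≡ (sym (antipode-< A<N)))
        s₂ : SameSeg (chord (suc (i + k)) (suc r)) (antiSeg N (i , suc (i + (N + k))))
        s₂ = inj₂ (sym (trans (cong (antipode N) j≡) (antipode-+ N (suc (i + k)))) , trans end≡ (sym (antipode-< i<N)))

ray-normal-form : ∀ {N d} → IsDiag N d → RayNormalForm N d
ray-normal-form {N} {i , j} (i+1<j , j<2N , not-edge) with m≤n⇒∃[o]m+o≡n i+1<j
... | k′ , refl = subst (λ j → RayNormalForm N (i , j)) (cong suc (+-suc i k′))
                    (normal-form i (suc k′) z<s (subst (_< 2 * N) (sym (+-suc (suc i) k′)) j<2N)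
                      (λ (i≡0 , e) → not-edge (i≡0 , trans (cong (suc ∘ suc) (sym (+-suc i k′))) e)))
  where
    normal-form : ∀ i k → 0 < k → suc (i + k) < 2 * N → ¬ (i ≡ 0 × suc (suc (i + k)) ≡ 2 * N) →
                  RayNormalForm N (i , suc (i + k))
    normal-form i k 0<k j<2N not-edge with i <? N | k <? N
    ... | yes i<N | yes k<N = i , k , (i<N , 0<k , k<N) , inj₁ (inj₁ (refl , refl))
    ... | yes i<N | no k≮N with m≤n⇒∃[o]m+o≡n (≮⇒≥ k≮N)
    ...   | k′ , refl = wrapping-normal-form i k′ i<N j<2N not-edge
    normal-form i k 0<k j<2N not-edge | no i≮N | _ with m≤n⇒∃[o]m+o≡n (≮⇒≥ i≮N)
    ...   | A , refl = shifted-normal-form A k 0<k j<2N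

StaggerOffsets : ℕ → ℕ → ℕ → ℕ → Set
StaggerOffsets C l A k = ∃ λ p → ∃ λ m → ∃ λ r → A ≡ C + suc p × l ≡ suc p + m × k ≡ m + suc r

staggered⇒offsets : ∀ {C l A k} → Staggered (chord C l) (chord A k) → StaggerOffsets C l A k
staggered⇒offsets {C} {l} {A} {k} (C<A , A≤C+l , C+l<A+k) with m≤n⇒∃[o]m+o≡n C<A
... | p , refl with m≤n⇒∃[o]m+o≡n (s≤s⁻¹ A≤C+l)
... | m , C+l≡ with m≤n⇒∃[o]m+o≡n (s≤s⁻¹ C+l<A+k)
... | r , A+k≡ = p , m , r , sym (+-suc C p) ,
  +-cancelˡ-≡ C l (suc p + m) (trans (sym C+l≡) (rearrange₁ C p m)) ,
  +-cancelˡ-≡ (suc C + p) k (m + suc r) (trans (sym A+k≡) (trans (cong (λ x → suc (x + r)) (sym C+l≡)) (rearrange₂ C p m r)))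
  where
    rearrange₁ : ∀ C p m → suc C + p + m ≡ C + (suc p + m)
    rearrange₁ = solve-∀
    rearrange₂ : ∀ C p m r → suc (suc C + p + m + r) ≡ suc C + p + (m + suc r)
    rearrange₂ = solve-∀

offsets⇒staggered : ∀ {C l A k} → StaggerOffsets C l A k → Staggered (chord C l) (chord A k)
offsets⇒staggered {C} (p , m , r , refl , refl , refl) =
  m<m+n C z<s , s≤s (+-monoʳ-≤ C (m≤m+n (suc p) m)) , s<s (subst (C + (suc p + m) <_) (rearrange C p m r) (m<m+n _ z<s))
  where
    rearrange : ∀ C p m r → C + (suc p + m) + suc r ≡ C + suc p + (m + suc r)
    rearrange = solve-∀

shift-chord : ∀ N A k → shift N (chord A k) ≡ chord (A + N) k
shift-chord N A k = cong (A + N ,_) (rearrange A k N)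
  where
    rearrange : ∀ A k N → suc (A + k) + N ≡ suc (A + N + k)
    rearrange = solve-∀

¬Overlap-self : ∀ {N A k} → k < N → ¬ Overlap N A k A k
¬Overlap-self k<N (inj₁ (A<A , _))          = <-irrefl refl A<A
¬Overlap-self {N} {A} {k} k<N (inj₂ (_ , A+N<B , _)) = <⇒≱ k<N (+-cancelˡ-≤ A N k (s≤s⁻¹ A+N<B))

-- Finite sums of rationals

χ : ∀ {P : Set} → Dec P → ℚ
χ (yes _) = 1ℚ
χ (no _)  = 0ℚ

*-neg-1 : ∀ c → c ℚ.* (0ℚ ℚ.- 1ℚ) ≡ ℚ.- c
*-neg-1 c = trans (sym (ℚ.neg-distribʳ-* c 1ℚ)) (cong ℚ.-_ (ℚ.*-identityʳ c))

module _ {P Q : Set} {c : ℚ} where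

  *-χ-diff-pos : (P? : Dec P) (Q? : Dec Q) → 0ℚ ℚ.≤ c → 0ℚ ℚ.< c ℚ.* (χ P? ℚ.- χ Q?) → P × ¬ Q × 0ℚ ℚ.< c
  *-χ-diff-pos (yes p) (no ¬q) _   pos = p , ¬q , subst (0ℚ ℚ.<_) (ℚ.*-identityʳ c) pos
  *-χ-diff-pos (yes _) (yes _) _   pos = contradiction (subst (0ℚ ℚ.<_) (ℚ.*-zeroʳ c) pos) (ℚ.<-irrefl refl)
  *-χ-diff-pos (no _)  (no _)  _   pos = contradiction (subst (0ℚ ℚ.<_) (ℚ.*-zeroʳ c) pos) (ℚ.<-irrefl refl)
  *-χ-diff-pos (no _)  (yes _) 0≤c pos =
    contradiction (ℚ.<-≤-trans (subst (0ℚ ℚ.<_) (*-neg-1 c) pos) (ℚ.neg-antimono-≤ 0≤c)) (ℚ.<-irrefl refl)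

  *-χ-diff-nonpos : (P? : Dec P) (Q? : Dec Q) → 0ℚ ℚ.≤ c → ¬ (P × ¬ Q) → c ℚ.* (χ P? ℚ.- χ Q?) ℚ.≤ 0ℚ
  *-χ-diff-nonpos (yes p) (no ¬q) _   ¬P¬Q = contradiction (p , ¬q) ¬P¬Q
  *-χ-diff-nonpos (yes _) (yes _) _   _    = ℚ.≤-reflexive (ℚ.*-zeroʳ c)
  *-χ-diff-nonpos (no _)  (no _)  _   _    = ℚ.≤-reflexive (ℚ.*-zeroʳ c)
  *-χ-diff-nonpos (no _)  (yes _) 0≤c _    = subst (ℚ._≤ 0ℚ) (sym (*-neg-1 c)) (ℚ.neg-antimono-≤ 0≤c)

  *-χ-diff-neg : (P? : Dec P) (Q? : Dec Q) → 0ℚ ℚ.< c → ¬ P → Q → c ℚ.* (χ P? ℚ.- χ Q?) ℚ.< 0ℚ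
  *-χ-diff-neg (yes p) _       _   ¬p _ = contradiction p ¬p
  *-χ-diff-neg (no _)  (no ¬q) _   _  q = contradiction q ¬q
  *-χ-diff-neg (no _)  (yes _) 0<c _  _ = subst (ℚ._< 0ℚ) (sym (*-neg-1 c)) (ℚ.neg-antimono-< 0<c)

χ-diff-pos : ∀ {P Q : Set} (P? : Dec P) (Q? : Dec Q) → P → ¬ Q → 0ℚ ℚ.< χ P? ℚ.- χ Q?
χ-diff-pos (yes _) (no _)  _ _  = ℚ.positive⁻¹ 1ℚ
χ-diff-pos (no ¬p) _       p _  = contradiction p ¬p
χ-diff-pos _       (yes q) _ ¬q = contradiction q ¬q

χ-diff-neg : ∀ {P Q : Set} (P? : Dec P) (Q? : Dec Q) → χ P? ℚ.- χ Q? ℚ.< 0ℚ → Q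
χ-diff-neg P? (yes q) _ = q
χ-diff-neg (yes _) (no _) neg = contradiction neg (ℚ.<-asym (ℚ.positive⁻¹ 1ℚ))
χ-diff-neg (no _)  (no _) neg = contradiction neg (ℚ.<-irrefl refl)

sumℚ-nonpos : ∀ {k} (f : Fin k → ℚ) → (∀ i → f i ℚ.≤ 0ℚ) → sumℚ f ℚ.≤ 0ℚ
sumℚ-nonpos {ℕ.zero}  f nonpos = ℚ.≤-refl
sumℚ-nonpos {ℕ.suc k} f nonpos = ℚ.+-mono-≤ (nonpos Fin.zero) (sumℚ-nonpos (f ∘ Fin.suc) (nonpos ∘ Fin.suc))

sumℚ-neg : ∀ {k} (f : Fin k → ℚ) → (∀ i → f i ℚ.≤ 0ℚ) → ∀ j → f j ℚ.< 0ℚ → sumℚ f ℚ.< 0ℚ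
sumℚ-neg f nonpos Fin.zero    neg = ℚ.+-mono-<-≤ neg (sumℚ-nonpos (f ∘ Fin.suc) (nonpos ∘ Fin.suc))
sumℚ-neg f nonpos (Fin.suc j) neg = ℚ.+-mono-≤-< (nonpos Fin.zero) (sumℚ-neg (f ∘ Fin.suc) (nonpos ∘ Fin.suc) j neg)

sumℚ-pos : ∀ {k} (f : Fin k → ℚ) → 0ℚ ℚ.< sumℚ f → ∃ λ i → 0ℚ ℚ.< f i
sumℚ-pos {ℕ.zero}  f pos = contradiction pos (ℚ.<-irrefl refl)
sumℚ-pos {ℕ.suc k} f pos with 0ℚ ℚ.<? f Fin.zero
... | yes f₀>0 = Fin.zero , f₀>0
... | no f₀≯0 = Product.map Fin.suc id (sumℚ-pos (f ∘ Fin.suc) (ℚ.≰⇒> rest≰0))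
  where
    rest≰0 : ¬ (sumℚ (f ∘ Fin.suc) ℚ.≤ 0ℚ)
    rest≰0 rest≤0 = ℚ.<-irrefl refl (ℚ.<-≤-trans pos (ℚ.+-mono-≤ (ℚ.≮⇒≥ f₀≯0) rest≤0))

sumℚ-zero : ∀ {k} (f : Fin k → ℚ) → (∀ i → f i ≡ 0ℚ) → sumℚ f ≡ 0ℚ
sumℚ-zero {ℕ.zero}  f f≡0 = refl
sumℚ-zero {ℕ.suc k} f f≡0 = cong₂ ℚ._+_ (f≡0 Fin.zero) (sumℚ-zero (f ∘ Fin.suc) (f≡0 ∘ Fin.suc))

sumℚ-*-sub : ∀ {k} (c f g : Fin k → ℚ) →
             sumℚ (λ i → c i ℚ.* f i) ℚ.- sumℚ (λ i → c i ℚ.* g i) ≡ sumℚ (λ i → c i ℚ.* (f i ℚ.- g i))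
sumℚ-*-sub {ℕ.zero}  c f g = refl
sumℚ-*-sub {ℕ.suc k} c f g =
  trans (regroup (c Fin.zero) (f Fin.zero) (g Fin.zero)
                 (sumℚ (λ i → c (Fin.suc i) ℚ.* f (Fin.suc i))) (sumℚ (λ i → c (Fin.suc i) ℚ.* g (Fin.suc i))))
        (cong (c Fin.zero ℚ.* (f Fin.zero ℚ.- g Fin.zero) ℚ.+_) (sumℚ-*-sub (c ∘ Fin.suc) (f ∘ Fin.suc) (g ∘ Fin.suc)))
  where
    regroup : ∀ c f g s t → (c ℚ.* f ℚ.+ s) ℚ.- (c ℚ.* g ℚ.+ t) ≡ c ℚ.* (f ℚ.- g) ℚ.+ (s ℚ.- t)
    regroup = solve 5 (λ c f g s t → (c :* f :+ s) :- (c :* g :+ t) := c :* (f :- g) :+ (s :- t)) refl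

sumℚ-updateAt : ∀ {k} (c : Fin k → ℚ) p q (g : Fin k → ℚ) →
                sumℚ (λ i → updateAt c p (q ℚ.+_) i ℚ.* g i) ≡ q ℚ.* g p ℚ.+ sumℚ (λ i → c i ℚ.* g i)
sumℚ-updateAt c Fin.zero q g = regroup q (c Fin.zero) (g Fin.zero) (sumℚ (λ i → c (Fin.suc i) ℚ.* g (Fin.suc i)))
  where
    regroup : ∀ q c g s → (q ℚ.+ c) ℚ.* g ℚ.+ s ≡ q ℚ.* g ℚ.+ (c ℚ.* g ℚ.+ s)
    regroup = solve 4 (λ q c g s → (q :+ c) :* g :+ s := q :* g :+ (c :* g :+ s)) refl
sumℚ-updateAt c (Fin.suc p) q g =
  trans (cong (c Fin.zero ℚ.* g Fin.zero ℚ.+_) (sumℚ-updateAt (c ∘ Fin.suc) p q (g ∘ Fin.suc)))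
        (regroup (c Fin.zero ℚ.* g Fin.zero) (q ℚ.* g (Fin.suc p)) (sumℚ (λ i → c (Fin.suc i) ℚ.* g (Fin.suc i))))
  where
    regroup : ∀ x y z → x ℚ.+ (y ℚ.+ z) ≡ y ℚ.+ (x ℚ.+ z)
    regroup = solve 3 (λ x y z → x :+ (y :+ z) := y :+ (x :+ z)) refl

updateAt-nonneg : ∀ {k} {c : Fin k → ℚ} {q} → (∀ i → 0ℚ ℚ.≤ c i) → 0ℚ ℚ.≤ q →
                  ∀ p i → 0ℚ ℚ.≤ updateAt c p (q ℚ.+_) i
updateAt-nonneg {c = c} {q} c≥0 q≥0 p i with i Fin.≟ p
... | yes refl = subst (0ℚ ℚ.≤_) (sym (updateAt-updates i c)) (ℚ.+-mono-≤ q≥0 (c≥0 i))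
... | no i≢p   = subst (0ℚ ℚ.≤_) (sym (updateAt-minimal i p c i≢p)) (c≥0 i)

allPairs-tabulate : ∀ {A : Set} {R : A → A → Set} {xs : List A} → (∀ {x y} → x ∈ xs → y ∈ xs → R x y) → AllPairs R xs
allPairs-tabulate {xs = []}     R = []
allPairs-tabulate {xs = x ∷ xs} R =
  All.tabulate (R (here refl) ∘ there) ∷ allPairs-tabulate (λ x∈ y∈ → R (there x∈) (there y∈))

-- Walks on the blossomed n-cycle

module _ (n : ℕ) .{{_ : NonZero n}} where

  infixl 6 _⊕ₙ_
  _⊕ₙ_ : Fin n → ℕ → Fin n
  i ⊕ₙ k = _⊕_ n i k

  toℕ-⊕ : ∀ i k → toℕ (i ⊕ₙ k) ≡ (toℕ i + k) % n
  toℕ-⊕ i k = toℕ-fromℕ< _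

  ⊕-identityʳ : ∀ i → i ⊕ₙ 0 ≡ i
  ⊕-identityʳ i = toℕ-injective (trans (toℕ-⊕ i 0) (trans (cong (_% n) (+-identityʳ (toℕ i))) (m<n⇒m%n≡m (toℕ<n i))))

  ⊕-period : ∀ i → i ⊕ₙ n ≡ i
  ⊕-period i = toℕ-injective (trans (toℕ-⊕ i n) (trans ([m+n]%n≡m%n (toℕ i) n) (m<n⇒m%n≡m (toℕ<n i))))

  ⊕-assoc : ∀ i p q → i ⊕ₙ p ⊕ₙ q ≡ i ⊕ₙ (p + q)
  ⊕-assoc i p q = toℕ-injective (begin
    toℕ (i ⊕ₙ p ⊕ₙ q)                     ≡⟨ toℕ-⊕ (i ⊕ₙ p) q ⟩
    (toℕ (i ⊕ₙ p) + q) % n                ≡⟨ cong (λ x → (x + q) % n) (toℕ-⊕ i p) ⟩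
    ((toℕ i + p) % n + q) % n             ≡⟨ %-distribˡ-+ ((toℕ i + p) % n) q n ⟩
    ((toℕ i + p) % n % n + q % n) % n     ≡⟨ cong (λ x → (x + q % n) % n) (m%n%n≡m%n (toℕ i + p) n) ⟩
    ((toℕ i + p) % n + q % n) % n         ≡⟨ %-distribˡ-+ (toℕ i + p) q n ⟨
    (toℕ i + p + q) % n                   ≡⟨ cong (_% n) (+-assoc (toℕ i) p q) ⟩
    (toℕ i + (p + q)) % n                 ≡⟨ toℕ-⊕ i (p + q) ⟨
    toℕ (i ⊕ₙ (p + q))                    ∎)
    where open ≡-Reasoning

  ⊕-suc : ∀ i p → i ⊕ₙ p ⊕ₙ 1 ≡ i ⊕ₙ suc p
  ⊕-suc i p = trans (⊕-assoc i p 1) (cong (i ⊕ₙ_) (+-comm p 1))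

  ⊕-lift : ∀ c p → p < n → toℕ c + p ≡ toℕ (c ⊕ₙ p) ⊎ toℕ c + p ≡ toℕ (c ⊕ₙ p) + n
  ⊕-lift c p p<n with toℕ c + p <? n
  ... | yes x<n = inj₁ (sym (trans (toℕ-⊕ c p) (m<n⇒m%n≡m x<n)))
  ... | no x≮n = inj₂ (sym (trans (cong (_+ n) (toℕ-⊕ c p)) (trans (cong (_+ n) x%n≡x∸n) (m∸n+n≡m (≮⇒≥ x≮n)))))
    where
      x = toℕ c + p
      x∸n<n : x ∸ n < n
      x∸n<n = +-cancelʳ-< n _ n (subst (_< n + n) (sym (m∸n+n≡m (≮⇒≥ x≮n))) (+-mono-< (toℕ<n c) p<n))
      x%n≡x∸n : x % n ≡ x ∸ n
      x%n≡x∸n = trans (cong (_% n) (sym (m∸n+n≡m (≮⇒≥ x≮n)))) (trans ([m+n]%n≡m%n (x ∸ n) n) (m<n⇒m%n≡m x∸n<n))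

  ⊕-from-lift : ∀ a c p → toℕ c + p ≡ toℕ a ⊎ toℕ c + p ≡ toℕ a + n → c ⊕ₙ p ≡ a
  ⊕-from-lift a c p lift = toℕ-injective (trans (toℕ-⊕ c p) (reduce lift))
    where
      reduce : toℕ c + p ≡ toℕ a ⊎ toℕ c + p ≡ toℕ a + n → (toℕ c + p) % n ≡ toℕ a
      reduce (inj₁ eq) = trans (cong (_% n) eq) (m<n⇒m%n≡m (toℕ<n a))
      reduce (inj₂ eq) = trans (cong (_% n) eq) (trans ([m+n]%n≡m%n (toℕ a) n) (m<n⇒m%n≡m (toℕ<n a)))

  ⊕-lifts-apart : ∀ a {p q} → q < n → toℕ a + p ≡ toℕ (a ⊕ₙ p) → toℕ a + q ≡ toℕ (a ⊕ₙ q) + n →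
                  a ⊕ₙ p ≢ a ⊕ₙ q
  ⊕-lifts-apart a {p} {q} q<n x y eq = m+n≮n p n (subst (_< n) q≡p+n q<n)
    where
      q≡p+n : q ≡ p + n
      q≡p+n = +-cancelˡ-≡ (toℕ a) q (p + n)
                (trans y (trans (cong (λ i → toℕ i + n) (sym eq)) (trans (cong (_+ n) (sym x)) (+-assoc (toℕ a) p n))))

  ⊕-cancelˡ : ∀ a {p q} → p < n → q < n → a ⊕ₙ p ≡ a ⊕ₙ q → p ≡ q
  ⊕-cancelˡ a {p} {q} p<n q<n eq with ⊕-lift a p p<n | ⊕-lift a q q<n
  ... | inj₁ x | inj₁ y = +-cancelˡ-≡ (toℕ a) p q (trans x (trans (cong toℕ eq) (sym y)))
  ... | inj₂ x | inj₂ y = +-cancelˡ-≡ (toℕ a) p q (trans x (trans (cong (λ i → toℕ i + n) eq) (sym y)))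
  ... | inj₁ x | inj₂ y = contradiction eq (⊕-lifts-apart a q<n x y)
  ... | inj₂ x | inj₁ y = contradiction (sym eq) (⊕-lifts-apart a p<n y x)

  cycPath-length : ∀ a k → length (cycPath n a k) ≡ k
  cycPath-length a zero    = refl
  cycPath-length a (suc k) = cong suc (cycPath-length (a ⊕ₙ 1) k)

  cycPath-++ : ∀ a p q → cycPath n a (p + q) ≡ cycPath n a p ++ cycPath n (a ⊕ₙ p) q
  cycPath-++ a zero    q = cong (λ b → cycPath n b q) (sym (⊕-identityʳ a))
  cycPath-++ a (suc p) q =
    cong (cyc a ∷_) (trans (cycPath-++ (a ⊕ₙ 1) p q) (cong (λ b → cycPath n (a ⊕ₙ 1) p ++ cycPath n b q) (⊕-assoc a 1 p)))

  cycPath-++-∷ : ∀ c p m → cycPath n c (suc p + m) ≡ cycPath n c p ++ cyc (c ⊕ₙ p) ∷ cycPath n (c ⊕ₙ suc p) m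
  cycPath-++-∷ c p m =
    trans (cong (cycPath n c) (sym (+-suc p m)))
          (trans (cycPath-++ c p (suc m)) (cong (λ b → cycPath n c p ++ cyc (c ⊕ₙ p) ∷ cycPath n b m) (⊕-suc c p)))

  ++-∷≢[] : ∀ {A : Set} (xs : List A) {y ys} → xs ++ y ∷ ys ≢ []
  ++-∷≢[] xs eq with ++-conicalʳ xs _ eq
  ... | ()

  blue-in-tail : ∀ a k {o} P {e} R → cycPath n a k ++ o ∷ [] ≡ P ++ e ∷ R → colour e ≡ blue →
                 cycPath n a k ≡ P × R ≡ []
  blue-in-tail a zero    []      R eq _ with ∷-injective eq
  ... | refl , refl = refl , refl
  blue-in-tail a (suc k) []      R eq e-blue with ∷-injective eq
  ... | refl , _ with e-blue
  ... | ()
  blue-in-tail a zero    (_ ∷ P) R eq _ = contradiction (sym (∷-injectiveʳ eq)) (++-∷≢[] P)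
  blue-in-tail a (suc k) (_ ∷ P) R eq e-blue with ∷-injective eq
  ... | refl , eq′ = Product.map₁ (cong (cyc a ∷_)) (blue-in-tail (a ⊕ₙ 1) k P R eq′ e-blue)

  red-in-tail : ∀ a k {o} es {f} Q → cycPath n a k ++ o ∷ [] ≡ es ++ f ∷ Q → colour f ≡ red → colour o ≡ blue →
                length es < k
  red-in-tail a zero    []       Q eq f-red o-blue with ∷-injective eq
  ... | refl , _ with trans (sym f-red) o-blue
  ... | ()
  red-in-tail a (suc k) []       Q eq _ _ = z<s
  red-in-tail a zero    (_ ∷ es) Q eq _ _ = contradiction (sym (∷-injectiveʳ eq)) (++-∷≢[] es)
  red-in-tail a (suc k) (_ ∷ es) Q eq f-red o-blue = s<s (red-in-tail (a ⊕ₙ 1) k es Q (∷-injectiveʳ eq) f-red o-blue)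

  cycPath-split : ∀ c l P {e} es → cycPath n c l ≡ P ++ e ∷ es → l ≡ length P + suc (length es) × e ≡ cyc (c ⊕ₙ length P)
  cycPath-split c zero    P       es eq = contradiction (sym eq) (++-∷≢[] P)
  cycPath-split c (suc l) []      es eq with ∷-injective eq
  ... | refl , eq′ = cong suc (trans (sym (cycPath-length (c ⊕ₙ 1) l)) (cong length eq′)) , cong cyc (sym (⊕-identityʳ c))
  cycPath-split c (suc l) (_ ∷ P) es eq with ∷-injective eq
  ... | refl , eq′ with cycPath-split (c ⊕ₙ 1) l P es eq′
  ... | l≡ , e≡ = cong suc l≡ , trans e≡ (cong cyc (⊕-assoc c 1 (length P)))

  -- The walk of length l from c reaches a after suc p cycle steps, runs along the walk of length k
  -- from a for m steps, and exits r + 1 steps before it.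
  Meets : Fin n → ℕ → Fin n → ℕ → Set
  Meets a k c l = ∃ λ p → ∃ λ m → ∃ λ r → a ≡ c ⊕ₙ suc p × l ≡ suc p + m × k ≡ m + suc r

  cv-injective : ∀ {x y : Fin n} → Vertex.cv x ≡ cv y → x ≡ y
  cv-injective refl = refl

  incompatibleAt⇒meets : ∀ a k c l → IncompatibleAt n (walk a k) (walk c l) → Meets a k c l
  incompatibleAt⇒meets a k c l
    (_ , es , P , e , f , Q , P′ , e′ , f′ , Q′ , ρ≡ , ρ′≡ , e↦v , e′↦v , e-blue , f′-blue , f-red , e′-red) =
    split P ρ≡ P′ ρ′≡
    where
      split : ∀ P → edgesOf n (walk a k) ≡ P ++ e ∷ (es ++ f ∷ Q) →
              ∀ P′ → edgesOf n (walk c l) ≡ P′ ++ e′ ∷ (es ++ f′ ∷ Q′) → Meets a k c l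
      split (_ ∷ P) ρ≡ _ _ = contradiction (proj₂ (blue-in-tail a k P _ (∷-injectiveʳ ρ≡) e-blue)) (++-∷≢[] es)
      split [] ρ≡ [] ρ′≡ = contradiction (trans (cong colour (∷-injectiveˡ ρ′≡)) e′-red) λ ()
      split [] ρ≡ (_ ∷ P′) ρ′≡ = length P′ , length es , proj₁ k-split , a≡ , l≡ , proj₂ k-split
        where
          k-split : ∃ λ r → k ≡ length es + suc r
          k-split = Product.map₂ (λ eq → trans (sym eq) (sym (+-suc (length es) _)))
                      (m≤n⇒∃[o]m+o≡n (red-in-tail a k es Q (∷-injectiveʳ ρ≡) f-red refl))
          c-split = cycPath-split c l P′ es
                      (proj₁ (blue-in-tail c l (P′ ++ e′ ∷ es) Q′
                               (trans (∷-injectiveʳ ρ′≡) (sym (++-assoc P′ (e′ ∷ es) (f′ ∷ Q′)))) f′-blue))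
          l≡ : l ≡ suc (length P′) + length es
          l≡ = trans (proj₁ c-split) (+-suc (length P′) (length es))
          a≡ : a ≡ c ⊕ₙ suc (length P′)
          a≡ = trans (cv-injective (begin
            cv a                               ≡⟨ cong (target n) (∷-injectiveˡ ρ≡) ⟩
            target n e                         ≡⟨ trans e↦v (sym e′↦v) ⟩
            target n e′                        ≡⟨ cong (target n) (proj₂ c-split) ⟩
            cv (c ⊕ₙ length P′ ⊕ₙ 1)           ∎))
            (⊕-suc c (length P′))
            where open ≡-Reasoning

  meets⇒incompatibleAt : ∀ a k c l → Meets a k c l → IncompatibleAt n (walk a k) (walk c l)
  meets⇒incompatibleAt .(c ⊕ₙ suc p) .(m + suc r) c .(suc p + m) (p , m , r , refl , refl , refl) =
      cv a , cycPath n a m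
    , [] , inE a , cyc (a ⊕ₙ m) , cycPath n (a ⊕ₙ m ⊕ₙ 1) r ++ outE (a ⊕ₙ (m + suc r)) ∷ []
    , inE c ∷ cycPath n c p , cyc (c ⊕ₙ p) , outE (c ⊕ₙ (suc p + m)) , []
    , ρ≡ , ρ′≡ , refl , cong cv (⊕-suc c p) , refl , refl , refl , refl
    where
      a = c ⊕ₙ suc p
      ρ≡ : edgesOf n (walk a (m + suc r)) ≡
           inE a ∷ (cycPath n a m ++ cyc (a ⊕ₙ m) ∷ (cycPath n (a ⊕ₙ m ⊕ₙ 1) r ++ outE (a ⊕ₙ (m + suc r)) ∷ []))
      ρ≡ = cong (inE a ∷_) (trans (cong (_++ outE (a ⊕ₙ (m + suc r)) ∷ []) (cycPath-++ a m (suc r)))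
                                 (++-assoc (cycPath n a m) _ _))
      ρ′≡ : edgesOf n (walk c (suc p + m)) ≡
            (inE c ∷ cycPath n c p) ++ cyc (c ⊕ₙ p) ∷ (cycPath n a m ++ outE (c ⊕ₙ (suc p + m)) ∷ [])
      ρ′≡ = cong (inE c ∷_) (trans (cong (_++ outE (c ⊕ₙ (suc p + m)) ∷ []) (cycPath-++-∷ c p m))
                                  (++-assoc (cycPath n c p) _ _))

  meets⇒overlap : ∀ a k c l → l < n → Meets a k c l → Overlap n (toℕ a) k (toℕ c) l
  meets⇒overlap a k c l l<n (p , m , r , a≡ , l≡ , k≡) = lifted (⊕-lift c (suc p) p<n)
    where
      p<n : suc p < n
      p<n = ≤-<-trans (subst (suc p ≤_) (sym l≡) (m≤m+n (suc p) m)) l<n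
      staggered : Staggered (chord (toℕ c) l) (chord (toℕ c + suc p) k)
      staggered = offsets⇒staggered (p , m , r , refl , l≡ , k≡)
      staggered-at : ∀ {A} → toℕ c + suc p ≡ A → Staggered (chord (toℕ c) l) (chord A k)
      staggered-at eq = subst (λ A → Staggered (chord (toℕ c) l) (chord A k)) eq staggered
      lifted : toℕ c + suc p ≡ toℕ (c ⊕ₙ suc p) ⊎ toℕ c + suc p ≡ toℕ (c ⊕ₙ suc p) + n →
               Overlap n (toℕ a) k (toℕ c) l
      lifted (inj₁ eq) = inj₁ (staggered-at (trans eq (cong toℕ (sym a≡))))
      lifted (inj₂ eq) = inj₂ (subst (Staggered (chord (toℕ c) l)) (sym (shift-chord n (toℕ a) k))
                                     (staggered-at (trans eq (cong (λ x → toℕ x + n) (sym a≡)))))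

  overlap⇒meets : ∀ a k c l → Overlap n (toℕ a) k (toℕ c) l → Meets a k c l
  overlap⇒meets a k c l (inj₁ st) with staggered⇒offsets st
  ... | p , m , r , A≡ , l≡ , k≡ = p , m , r , sym (⊕-from-lift a c (suc p) (inj₁ (sym A≡))) , l≡ , k≡
  overlap⇒meets a k c l (inj₂ st) with staggered⇒offsets (subst (Staggered _) (shift-chord n (toℕ a) k) st)
  ... | p , m , r , A≡ , l≡ , k≡ = p , m , r , sym (⊕-from-lift a c (suc p) (inj₂ (sym A≡))) , l≡ , k≡

  overlapping⇒incompatible : ∀ a k c l → Overlapping n (toℕ a) k (toℕ c) l → Incompatible n (walk a k) (walk c l)
  overlapping⇒incompatible a k c l (inj₁ o) = tt , tt , inj₁ (meets⇒incompatibleAt a k c l (overlap⇒meets a k c l o))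
  overlapping⇒incompatible a k c l (inj₂ o) = tt , tt , inj₂ (meets⇒incompatibleAt c l a k (overlap⇒meets c l a k o))

  incompatible⇒overlapping : ∀ a k c l → k < n → l < n → Incompatible n (walk a k) (walk c l) →
                             Overlapping n (toℕ a) k (toℕ c) l
  incompatible⇒overlapping a k c l k<n l<n (_ , _ , inj₁ i) = inj₁ (meets⇒overlap a k c l l<n (incompatibleAt⇒meets a k c l i))
  incompatible⇒overlapping a k c l k<n l<n (_ , _ , inj₂ i) = inj₂ (meets⇒overlap c l a k k<n (incompatibleAt⇒meets c l a k i))

  Good⇒<n : ∀ a k → Good n (walk a k) → k < n
  Good⇒<n a k (_ , _ , k , refl , refl , first) with k <? n
  ... | yes k<n = k<n
  ... | no k≮n = contradiction earlier (first (k ∸ n) (∸-monoʳ-< (>-nonZero⁻¹ n) n≤k))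
    where
      n≤k = ≮⇒≥ k≮n
      earlier : a ⊕ₙ (k ∸ n) ≡ a ⊕ₙ k
      earlier = begin
        a ⊕ₙ (k ∸ n)        ≡⟨ ⊕-period (a ⊕ₙ (k ∸ n)) ⟨
        a ⊕ₙ (k ∸ n) ⊕ₙ n   ≡⟨ ⊕-assoc a (k ∸ n) n ⟩
        a ⊕ₙ (k ∸ n + n)    ≡⟨ cong (a ⊕ₙ_) (m∸n+n≡m n≤k) ⟩
        a ⊕ₙ k              ∎
        where open ≡-Reasoning

  <n⇒Good : ∀ a k → k < n → Good n (walk a k)
  <n⇒Good a k k<n = a , a ⊕ₙ k , k , refl , refl , λ j j<k eq → <-irrefl (⊕-cancelˡ a (<-trans j<k k<n) k<n eq) j<k

  Allowed : Route n → Set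
  Allowed ρ = ρ ≡ cycle ⊎ Good n ρ

  allowed-walk<n : ∀ {a k} → Allowed (walk a k) → k < n
  allowed-walk<n {a} {k} (inj₂ good) = Good⇒<n a k good

  allowed-self-compatible : ∀ {ρ} → Allowed ρ → Compatible n ρ ρ
  allowed-self-compatible {cycle}    _       (() , _)
  allowed-self-compatible {walk a k} allowed x =
    [ ¬Overlap-self k<n , ¬Overlap-self k<n ] (incompatible⇒overlapping a k a k k<n k<n x)
    where k<n = allowed-walk<n allowed

  cycle-exceptional : Exceptional n cycle
  cycle-exceptional _ (() , _)

  trivial-exceptional : ∀ a → Exceptional n (walk a 0)
  trivial-exceptional a cycle      (_ , () , _)
  trivial-exceptional a (walk c l) (_ , _ , inj₁ i) with incompatibleAt⇒meets a 0 c l i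
  ... | _ , m , r , _ , _ , 0≡ = contradiction (trans 0≡ (+-suc m r)) λ ()
  trivial-exceptional a (walk c l) (_ , _ , inj₂ i) with incompatibleAt⇒meets c l a 0 i
  ... | _ , _ , _ , _ , () , _

  nontrivial-unexceptional : ∀ c l → ¬ Exceptional n (walk c (suc l))
  nontrivial-unexceptional c l exceptional =
    exceptional (walk c′ 1) (tt , tt , inj₁ (meets⇒incompatibleAt c (suc l) c′ 1 (0 , 0 , l , c≡ , refl , refl)))
    where
      c′ = c ⊕ₙ (n ∸ 1)
      c≡ : c ≡ c′ ⊕ₙ 1
      c≡ = sym (trans (⊕-assoc c (n ∸ 1) 1) (trans (cong (c ⊕ₙ_) (m∸n+n≡m (>-nonZero⁻¹ n))) (⊕-period c)))

  Incompatible-sym : ∀ {ρ σ} → Incompatible n ρ σ → Incompatible n σ ρ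
  Incompatible-sym (walk-ρ , walk-σ , at) = walk-σ , walk-ρ , swap at

  members-compatible : ∀ (C : CompatSet n) {ρ σ} → ρ ∈ routes C → σ ∈ routes C → Compatible n ρ σ
  members-compatible C ρ∈ σ∈ with ∈-AllPairs₂ (pairwise C) ρ∈ σ∈
  ... | inj₁ refl        = allowed-self-compatible (All.lookup (allowed C) ρ∈)
  ... | inj₂ (inj₁ ρ~σ) = ρ~σ
  ... | inj₂ (inj₂ σ~ρ) = σ~ρ ∘ Incompatible-sym

  -- Rays of compatible sets

  Proper : Fin n → ℕ → Set
  Proper a k = ProperChord n (toℕ a) k

  proper? : ∀ a k → Dec (Proper a k)
  proper? a k = toℕ a <? n ×-dec 0 <? k ×-dec k <? n

  diagonals : Route n → List (Diag n)
  diagonals cycle      = []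
  diagonals (walk a k) with proper? a k
  ... | yes p = (chord (toℕ a) k , chord-isDiag p) ∷ []
  ... | no _  = []

  ∈-diagonals⁻ : ∀ {ρ D} → D ∈ diagonals ρ →
                 ∃ λ a → ∃ λ k → ρ ≡ walk a k × Proper a k × proj₁ D ≡ chord (toℕ a) k
  ∈-diagonals⁻ {walk a k} D∈ with proper? a k
  ∈-diagonals⁻ {walk a k} (here refl) | yes p = a , k , refl , p , refl

  ∈-diagonals⁺ : ∀ {a k} → Proper a k → ∃ λ D → D ∈ diagonals (walk a k) × proj₁ D ≡ chord (toℕ a) k
  ∈-diagonals⁺ {a} {k} p with proper? a k
  ... | yes _ = _ , here refl , refl
  ... | no ¬p = contradiction p ¬p

  raysOf : CompatSet n → List (Diag n)
  raysOf C = concatMap diagonals (routes C)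

  DiagonalOfRoute : CompatSet n → Diag n → Set
  DiagonalOfRoute C D = ∃ λ a → ∃ λ k → walk a k ∈ routes C × Proper a k × proj₁ D ≡ chord (toℕ a) k

  ∈-raysOf⁻ : ∀ C {D} → D ∈ raysOf C → DiagonalOfRoute C D
  ∈-raysOf⁻ C D∈ with find (∈-concatMap⁻ diagonals {xs = routes C} D∈)
  ... | ρ , ρ∈ , D∈ρ with ∈-diagonals⁻ {ρ} D∈ρ
  ... | a , k , refl , p , D≡ = a , k , ρ∈ , p , D≡

  ∈-raysOf⁺ : ∀ C {a k} → walk a k ∈ routes C → Proper a k → ∃ λ D → D ∈ raysOf C × proj₁ D ≡ chord (toℕ a) k
  ∈-raysOf⁺ C ρ∈ p with ∈-diagonals⁺ p
  ... | D , D∈ , D≡ = D , ∈-concatMap⁺ diagonals (lose ρ∈ D∈) , D≡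

  raysOf-noncrossing : ∀ C → NoncrossingRays n (raysOf C)
  raysOf-noncrossing C D D′ D∈ D′∈ d d′ d∈D d′∈D′ x with ∈-raysOf⁻ C D∈ | ∈-raysOf⁻ C D′∈
  ... | a , k , ρ∈ , pa , D≡ | c , l , σ∈ , pc , D′≡ =
    members-compatible C ρ∈ σ∈ (overlapping⇒incompatible a k c l
      (crossing-rays⇒overlapping pa pc (subst (InRaySeg n d) D≡ d∈D) (subst (InRaySeg n d′) D′≡ d′∈D′) x))

  walk-chord-injective : ∀ {a b : Fin n} {k l} → walk a k ≡ walk b l → chord (toℕ a) k ≡ chord (toℕ b) l
  walk-chord-injective refl = refl

  record Representative (D : Diag n) : Set where
    field
      entry   : Fin n
      steps   : ℕ
      proper  : Proper entry steps
      sameRay : SameRaySeg n (proj₁ D) (chord (toℕ entry) steps)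

  representative : (D : Diag n) → Representative D
  representative (d , isDiag) with ray-normal-form isDiag
  ... | A , k , proper@(A<n , _) , same = record
    { entry   = fromℕ< A<n
    ; steps   = k
    ; proper  = subst (λ A → ProperChord n A k) A≡ proper
    ; sameRay = subst (λ A → SameRaySeg n d (chord A k)) A≡ same
    }
    where
      A≡ : A ≡ toℕ (fromℕ< A<n)
      A≡ = sym (toℕ-fromℕ< A<n)

  routeOf : Diag n → Route n
  routeOf D = walk (entry (representative D)) (steps (representative D))
    where open Representative

  module _ {S : List (Diag n)} (noncrossing : NoncrossingRays n S) where

    chords-¬overlap : ∀ {D₁ D₂ A₁ k₁ A₂ k₂} → D₁ ∈ S → D₂ ∈ S →
                      ProperChord n A₁ k₁ → SameRaySeg n (proj₁ D₁) (chord A₁ k₁) →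
                      ProperChord n A₂ k₂ → SameRaySeg n (proj₁ D₂) (chord A₂ k₂) → ¬ Overlap n A₁ k₁ A₂ k₂
    chords-¬overlap {D₁} {D₂} D₁∈ D₂∈ p₁ same₁ p₂ same₂ o with overlap⇒cross p₁ p₂ o
    ... | inj₁ x = noncrossing D₂ D₁ D₂∈ D₁∈ _ _ (SameRaySeg⇒InRaySeg˘ {n} same₂) (SameRaySeg⇒InRaySeg˘ {n} same₁) x
    ... | inj₂ x = noncrossing D₂ D₁ D₂∈ D₁∈ _ _ (SameRaySeg⇒antiSeg-InRaySeg˘ {n} same₂) (SameRaySeg⇒InRaySeg˘ {n} same₁) x

    routeOf-compatible : ∀ {D₁ D₂} → D₁ ∈ S → D₂ ∈ S → Compatible n (routeOf D₁) (routeOf D₂)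
    routeOf-compatible {D₁} {D₂} D₁∈ D₂∈ =
      [ chords-¬overlap D₁∈ D₂∈ p₁ same₁ p₂ same₂ , chords-¬overlap D₂∈ D₁∈ p₂ same₂ p₁ same₁ ]
        ∘ incompatible⇒overlapping _ _ _ _ (proj₂ (proj₂ p₁)) (proj₂ (proj₂ p₂))
      where
        open Representative
        p₁ = proper (representative D₁)
        p₂ = proper (representative D₂)
        same₁ = sameRay (representative D₁)
        same₂ = sameRay (representative D₂)

    compatSetOf : CompatSet n
    compatSetOf = compatSet (map routeOf S)
      (All.map⁺ (All.universal (λ D → inj₂ (<n⇒Good _ _ (proj₂ (proj₂ (Representative.proper (representative D)))))) S))
      (AllPairs.map⁺ (allPairs-tabulate routeOf-compatible))

    S⊆raysOf-compatSetOf : RaySub n S (raysOf compatSetOf)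
    S⊆raysOf-compatSetOf D D∈ = chosen (∈-raysOf⁺ compatSetOf (∈-map⁺ routeOf D∈) (proper r))
      where
        open Representative
        r = representative D
        chosen : ∃ (λ D′ → D′ ∈ raysOf compatSetOf × proj₁ D′ ≡ chord (toℕ (entry r)) (steps r)) →
                 ∃ λ D′ → D′ ∈ raysOf compatSetOf × SameRay n D D′
        chosen (D′ , D′∈ , D′≡) = D′ , D′∈ , subst (InRaySeg n (proj₁ D)) (sym D′≡) (SameRaySeg⇒InRaySeg {n} (sameRay r))

    raysOf-compatSetOf⊆S : RaySub n (raysOf compatSetOf) S
    raysOf-compatSetOf⊆S D′ D′∈ = from-route (∈-raysOf⁻ compatSetOf D′∈)
      where
        from-route : DiagonalOfRoute compatSetOf D′ → ∃ λ D → D ∈ S × SameRay n D′ D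
        from-route (a , k , ρ∈ , _ , D′≡) = from-diagonal (∈-map⁻ routeOf ρ∈)
          where
            from-diagonal : (∃ λ D → D ∈ S × walk a k ≡ routeOf D) → ∃ λ D → D ∈ S × SameRay n D′ D
            from-diagonal (D , D∈ , ρ≡) = D , D∈ , subst (λ d → InRaySeg n d (proj₁ D)) (sym (trans D′≡ (walk-chord-injective ρ≡)))
                                                       (SameRaySeg⇒InRaySeg˘ {n} (Representative.sameRay (representative D)))

  -- Cones of compatible sets

  combination : (ρs : List (Route n)) → (Fin (length ρs) → ℚ) → Flow n
  combination ρs c e = sumℚ (λ i → c i ℚ.* indicator n (lookup ρs i) e)

  combination-zero : ∀ ρs e → combination ρs (λ _ → 0ℚ) e ≡ 0ℚ
  combination-zero ρs e = sumℚ-zero _ (λ i → ℚ.*-zeroˡ (indicator n (lookup ρs i) e))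

  InRedCone-zero : ∀ ρs → InRedCone n ρs (λ _ → 0ℚ)
  InRedCone-zero ρs = (λ _ → 0ℚ) , (λ _ → ℚ.≤-refl) , [] , [] , (λ ()) , λ e →
    sym (trans (ℚ.+-identityʳ (combination ρs (λ _ → 0ℚ) e)) (combination-zero ρs e))

  InRedCone-add-member : ∀ {ρs ρ q} {x y : Flow n} → ρ ∈ ρs → 0ℚ ℚ.≤ q → InRedCone n ρs y →
                         (∀ e → x e ≡ q ℚ.* indicator n ρ e ℚ.+ y e) → InRedCone n ρs x
  InRedCone-add-member {ρs} {ρ} {q} {x} {y} ρ∈ q≥0 (lam , lam≥0 , Es , exceptional , mu , y≡) x≡ =
    updateAt lam p (q ℚ.+_) , updateAt-nonneg lam≥0 q≥0 p , Es , exceptional , mu , λ e → begin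
      x e                                                 ≡⟨ x≡ e ⟩
      q ℚ.* 𝟙 ρ e ℚ.+ y e                                 ≡⟨ cong₂ (λ σ z → q ℚ.* 𝟙 σ e ℚ.+ z) ρ≡ (y≡ e) ⟩
      q ℚ.* 𝟙 (lookup ρs p) e ℚ.+ (Σρs lam e ℚ.+ ΣEs e)   ≡⟨ ℚ.+-assoc (q ℚ.* 𝟙 (lookup ρs p) e) _ _ ⟨
      q ℚ.* 𝟙 (lookup ρs p) e ℚ.+ Σρs lam e ℚ.+ ΣEs e     ≡⟨ cong (ℚ._+ ΣEs e) (sumℚ-updateAt lam p q (λ i → 𝟙 (lookup ρs i) e)) ⟨
      Σρs (updateAt lam p (q ℚ.+_)) e ℚ.+ ΣEs e           ∎
    where
      open ≡-Reasoning
      p = Any.index ρ∈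
      ρ≡ = lookup-index ρ∈
      𝟙 = indicator n
      Σρs = combination ρs
      ΣEs = combination Es mu

  InRedCone-add-exceptional : ∀ {ρs τ q} {x y : Flow n} → Exceptional n τ → InRedCone n ρs y →
                              (∀ e → x e ≡ q ℚ.* indicator n τ e ℚ.+ y e) → InRedCone n ρs x
  InRedCone-add-exceptional {ρs} {τ} {q} {x} exceptional-τ (lam , lam≥0 , Es , exceptional , mu , y≡) x≡ =
    lam , lam≥0 , τ ∷ Es , exceptional-τ ∷ exceptional , q Vec.∷ mu , λ e →
      trans (x≡ e) (trans (cong (q ℚ.* indicator n τ e ℚ.+_) (y≡ e))
                          (regroup (q ℚ.* indicator n τ e) (combination ρs lam e) (combination Es mu e)))
    where
      regroup : ∀ x y z → x ℚ.+ (y ℚ.+ z) ≡ y ℚ.+ (x ℚ.+ z)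
      regroup = solve 3 (λ x y z → x :+ (y :+ z) := y :+ (x :+ z)) refl

  InRedCone-mono : ∀ {ρs′} ρs → (∀ {ρ} → ρ ∈ ρs → Exceptional n ρ ⊎ ρ ∈ ρs′) →
                   ∀ x → InRedCone n ρs x → InRedCone n ρs′ x
  InRedCone-mono {ρs′} [] covered x (_ , _ , Es , exceptional , mu , x≡) =
    (λ _ → 0ℚ) , (λ _ → ℚ.≤-refl) , Es , exceptional , mu , λ e →
      trans (x≡ e) (cong (ℚ._+ combination Es mu e) (sym (combination-zero ρs′ e)))
  InRedCone-mono {ρs′} (ρ ∷ ρs) covered x (lam , lam≥0 , Es , exceptional , mu , x≡) = extend (covered (here refl))
    where
      y : Flow n
      y e = combination ρs (lam ∘ Fin.suc) e ℚ.+ combination Es mu e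
      rest : InRedCone n ρs′ y
      rest = InRedCone-mono ρs (covered ∘ there) y (lam ∘ Fin.suc , lam≥0 ∘ Fin.suc , Es , exceptional , mu , λ _ → refl)
      x≡′ : ∀ e → x e ≡ lam Fin.zero ℚ.* indicator n ρ e ℚ.+ y e
      x≡′ e = trans (x≡ e) (ℚ.+-assoc (lam Fin.zero ℚ.* indicator n ρ e) _ _)
      extend : Exceptional n ρ ⊎ ρ ∈ ρs′ → InRedCone n ρs′ x
      extend (inj₁ exceptional-ρ) = InRedCone-add-exceptional {ρs′} {q = lam Fin.zero} exceptional-ρ rest x≡′
      extend (inj₂ ρ∈)            = InRedCone-add-member ρ∈ (lam≥0 Fin.zero) rest x≡′

  count : List (Edge n) → ℚ
  count es = ℤ.+ length es ℚ./ 1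

  cycPath-avoids : ∀ {e} → (∀ i → e ≢ cyc i) → ∀ c l → All (e ≢_) (cycPath n c l)
  cycPath-avoids e≢ c zero    = []
  cycPath-avoids e≢ c (suc l) = e≢ c ∷ cycPath-avoids e≢ (c ⊕ₙ 1) l

  cycle-avoids : ∀ {e} → (∀ i → e ≢ cyc i) → All (e ≢_) (edgesOf n cycle)
  cycle-avoids e≢ = All.map⁺ (All.universal e≢ (allFin n))

  indicator-walk-inE : ∀ c l v → indicator n (walk c l) (inE v) ≡ χ (v Fin.≟ c)
  indicator-walk-inE c l v = first (v Fin.≟ c)
    where
      rest = cycPath n c l ++ outE (c ⊕ₙ l) ∷ []
      rest≡[] : filter (inE v ≟E_) rest ≡ []
      rest≡[] = filter-none (inE v ≟E_) (All.++⁺ (cycPath-avoids (λ _ ()) c l) ((λ ()) ∷ []))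
      first : (v≟c : Dec (v ≡ c)) → indicator n (walk c l) (inE v) ≡ χ v≟c
      first (yes v≡c) =
        cong count (trans (filter-accept (inE v ≟E_) {x = inE c} {xs = rest} (cong inE v≡c)) (cong (inE c ∷_) rest≡[]))
      first (no v≢c)  =
        cong count (trans (filter-reject (inE v ≟E_) {x = inE c} {xs = rest} (λ { refl → v≢c refl })) rest≡[])

  indicator-walk-outE : ∀ c l v → indicator n (walk c l) (outE v) ≡ χ (v Fin.≟ c ⊕ₙ l)
  indicator-walk-outE c l v = trans (cong count only-last) (last (v Fin.≟ c ⊕ₙ l))
    where
      exit = outE (c ⊕ₙ l) ∷ []
      only-last : filter (outE v ≟E_) (edgesOf n (walk c l)) ≡ filter (outE v ≟E_) exit
      only-last = begin
        filter (outE v ≟E_) (inE c ∷ cycPath n c l ++ exit)                ≡⟨ filter-reject (outE v ≟E_) {x = inE c} {xs = cycPath n c l ++ exit} (λ ()) ⟩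
        filter (outE v ≟E_) (cycPath n c l ++ exit)                        ≡⟨ filter-++ (outE v ≟E_) (cycPath n c l) exit ⟩
        filter (outE v ≟E_) (cycPath n c l) ++ filter (outE v ≟E_) exit   ≡⟨ cong (_++ filter (outE v ≟E_) exit)
                                                                                  (filter-none (outE v ≟E_) (cycPath-avoids (λ _ ()) c l)) ⟩
        filter (outE v ≟E_) exit                                           ∎
        where open ≡-Reasoning
      last : (v≟b : Dec (v ≡ c ⊕ₙ l)) → count (filter (outE v ≟E_) exit) ≡ χ v≟b
      last (yes v≡b) = cong count (filter-accept (outE v ≟E_) {x = outE (c ⊕ₙ l)} {xs = []} (cong outE v≡b))
      last (no v≢b)  = cong count (filter-reject (outE v ≟E_) {x = outE (c ⊕ₙ l)} {xs = []} (λ { refl → v≢b refl }))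

  ∂ : Flow n → Fin n → ℚ
  ∂ x v = x (inE v) ℚ.- x (outE v)

  ∂-walk : ∀ c l v → ∂ (indicator n (walk c l)) v ≡ χ (v Fin.≟ c) ℚ.- χ (v Fin.≟ c ⊕ₙ l)
  ∂-walk c l v = cong₂ ℚ._-_ (indicator-walk-inE c l v) (indicator-walk-outE c l v)

  ∂-cycle : ∀ v → ∂ (indicator n cycle) v ≡ 0ℚ
  ∂-cycle v = cong₂ ℚ._-_ (cong count (filter-none (inE v ≟E_) (cycle-avoids (λ _ ()))))
                          (cong count (filter-none (outE v ≟E_) (cycle-avoids (λ _ ()))))

  ∂-exceptional : ∀ {τ} → Exceptional n τ → ∀ v → ∂ (indicator n τ) v ≡ 0ℚ
  ∂-exceptional {cycle}          _           v = ∂-cycle v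
  ∂-exceptional {walk c zero}    _           v =
    trans (∂-walk c 0 v)
          (trans (cong (λ b → χ (v Fin.≟ c) ℚ.- χ (v Fin.≟ b)) (⊕-identityʳ c)) (ℚ.+-inverseʳ (χ (v Fin.≟ c))))
  ∂-exceptional {walk c (suc l)} exceptional v = contradiction exceptional (nontrivial-unexceptional c l)

  ∂-combination : ∀ ρs c v → ∂ (combination ρs c) v ≡ sumℚ (λ i → c i ℚ.* ∂ (indicator n (lookup ρs i)) v)
  ∂-combination ρs c v = sumℚ-*-sub c _ _

  ∂-redCone : ∀ {ρs Es lam mu} {x : Flow n} → All (Exceptional n) Es →
              (∀ e → x e ≡ combination ρs lam e ℚ.+ combination Es mu e) →
              ∀ v → ∂ x v ≡ sumℚ (λ i → lam i ℚ.* ∂ (indicator n (lookup ρs i)) v)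
  ∂-redCone {ρs} {Es} {lam} {mu} {x} exceptional x≡ v = begin
    ∂ x v                                                      ≡⟨ cong₂ ℚ._-_ (x≡ (inE v)) (x≡ (outE v)) ⟩
    (Σρs (inE v) ℚ.+ ΣEs (inE v)) ℚ.- (Σρs (outE v) ℚ.+ ΣEs (outE v)) ≡⟨ regroup (Σρs (inE v)) _ _ _ ⟩
    ∂ Σρs v ℚ.+ ∂ ΣEs v                                        ≡⟨ cong₂ ℚ._+_ (∂-combination ρs lam v) ∂ΣEs≡0 ⟩
    Σ∂ ℚ.+ 0ℚ                                                  ≡⟨ ℚ.+-identityʳ Σ∂ ⟩
    Σ∂                                                         ∎
    where
      open ≡-Reasoning
      Σρs = combination ρs lam
      ΣEs = combination Es mu
      Σ∂ = sumℚ (λ i → lam i ℚ.* ∂ (indicator n (lookup ρs i)) v)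
      regroup : ∀ a b c d → (a ℚ.+ b) ℚ.- (c ℚ.+ d) ≡ (a ℚ.- c) ℚ.+ (b ℚ.- d)
      regroup = solve 4 (λ a b c d → (a :+ b) :- (c :+ d) := (a :- c) :+ (b :- d)) refl
      exceptional-terms : ∀ j → mu j ℚ.* ∂ (indicator n (lookup Es j) ) v ≡ 0ℚ
      exceptional-terms j = trans (cong (mu j ℚ.*_) (∂-exceptional (All.lookup exceptional (∈-lookup j)) v)) (ℚ.*-zeroʳ (mu j))
      ∂ΣEs≡0 : ∂ ΣEs v ≡ 0ℚ
      ∂ΣEs≡0 = trans (∂-combination Es mu v) (sumℚ-zero _ exceptional-terms)

  EntersAt : Route n → Fin n → Set
  EntersAt ρ v = ∃ λ l → ρ ≡ walk v l × v ⊕ₙ l ≢ v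

  positive-term : ∀ ρ v {c} → 0ℚ ℚ.≤ c → 0ℚ ℚ.< c ℚ.* ∂ (indicator n ρ) v → EntersAt ρ v × 0ℚ ℚ.< c
  positive-term cycle v {c} _ pos =
    contradiction (subst (0ℚ ℚ.<_) (trans (cong (c ℚ.*_) (∂-cycle v)) (ℚ.*-zeroʳ c)) pos) (ℚ.<-irrefl refl)
  positive-term (walk c′ l) v {c} c≥0 pos =
    entry (*-χ-diff-pos (v Fin.≟ c′) (v Fin.≟ c′ ⊕ₙ l) c≥0 (subst (λ t → 0ℚ ℚ.< c ℚ.* t) (∂-walk c′ l v) pos))
    where
      entry : v ≡ c′ × ¬ v ≡ c′ ⊕ₙ l × 0ℚ ℚ.< c → EntersAt (walk c′ l) v × 0ℚ ℚ.< c
      entry (v≡c′ , v≢c′⊕l , c>0) =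
        (l , cong (λ a → walk a l) (sym v≡c′) , λ v⊕l≡v → v≢c′⊕l (trans (sym v⊕l≡v) (cong (_⊕ₙ l) v≡c′))) , c>0

  nonpositive-term : ∀ ρ v {c} → 0ℚ ℚ.≤ c → ¬ EntersAt ρ v → c ℚ.* ∂ (indicator n ρ) v ℚ.≤ 0ℚ
  nonpositive-term cycle v {c} _ _ = ℚ.≤-reflexive (trans (cong (c ℚ.*_) (∂-cycle v)) (ℚ.*-zeroʳ c))
  nonpositive-term (walk c′ l) v {c} c≥0 ¬enters =
    subst (λ t → c ℚ.* t ℚ.≤ 0ℚ) (sym (∂-walk c′ l v)) (*-χ-diff-nonpos (v Fin.≟ c′) (v Fin.≟ c′ ⊕ₙ l) c≥0 enters)
    where
      enters : ¬ (v ≡ c′ × ¬ v ≡ c′ ⊕ₙ l)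
      enters (v≡c′ , v≢c′⊕l) = ¬enters (l , cong (λ a → walk a l) (sym v≡c′) , λ v⊕l≡v → v≢c′⊕l (trans (sym v⊕l≡v) (cong (_⊕ₙ l) v≡c′)))

  negative-term : ∀ {v l c} → 0ℚ ℚ.< c → v ⊕ₙ l ≢ v → c ℚ.* ∂ (indicator n (walk v l)) (v ⊕ₙ l) ℚ.< 0ℚ
  negative-term {v} {l} {c} c>0 v⊕l≢v =
    subst (λ t → c ℚ.* t ℚ.< 0ℚ) (sym (∂-walk v l (v ⊕ₙ l))) (*-χ-diff-neg (v ⊕ₙ l Fin.≟ v) (v ⊕ₙ l Fin.≟ v ⊕ₙ l) c>0 v⊕l≢v refl)

  junction-incompatible : ∀ a l l′ → a ⊕ₙ l ≢ a → a ⊕ₙ l ⊕ₙ l′ ≢ a ⊕ₙ l → Incompatible n (walk (a ⊕ₙ l) l′) (walk a l)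
  junction-incompatible a zero    _        a⊕0≢a _          = contradiction (⊕-identityʳ a) a⊕0≢a
  junction-incompatible a (suc l) zero     _     e⊕0≢e      = contradiction (⊕-identityʳ (a ⊕ₙ suc l)) e⊕0≢e
  junction-incompatible a (suc l) (suc l′) _     _          =
    tt , tt , inj₁ (meets⇒incompatibleAt (a ⊕ₙ suc l) (suc l′) a (suc l) (l , 0 , l′ , refl , sym (+-identityʳ (suc l)) , refl))

  redCone-walk-member : ∀ (C : CompatSet n) {a k} → Proper a k →
                        InRedCone n (routes C) (indicator n (walk a k)) → walk a k ∈ routes C
  redCone-walk-member C {a} {k} (_ , k>0 , k<n) (lam , lam≥0 , Es , exceptional , mu , 𝟙≡) =
    from-entering (sumℚ-pos (term a) source-surplus)
    where
      ρs = routes C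
      term : Fin n → Fin (length ρs) → ℚ
      term v i = lam i ℚ.* ∂ (indicator n (lookup ρs i)) v
      balance : ∀ v → χ (v Fin.≟ a) ℚ.- χ (v Fin.≟ a ⊕ₙ k) ≡ sumℚ (term v)
      balance v = trans (sym (∂-walk a k v)) (∂-redCone {ρs} {Es} {lam} {mu} exceptional 𝟙≡ v)
      b≢a : a ⊕ₙ k ≢ a
      b≢a b≡a = <-irrefl (⊕-cancelˡ a (>-nonZero⁻¹ n) k<n (trans (⊕-identityʳ a) (sym b≡a))) k>0
      source-surplus : 0ℚ ℚ.< sumℚ (term a)
      source-surplus = subst (0ℚ ℚ.<_) (balance a) (χ-diff-pos (a Fin.≟ a) (a Fin.≟ a ⊕ₙ k) refl (b≢a ∘ sym))
      from-entering : (∃ λ i → 0ℚ ℚ.< term a i) → walk a k ∈ ρs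
      from-entering (i , pos) = from-route (positive-term (lookup ρs i) a (lam≥0 i) pos)
        where
          from-route : EntersAt (lookup ρs i) a × 0ℚ ℚ.< lam i → walk a k ∈ ρs
          from-route ((l , ρᵢ≡ , e≢a) , lamᵢ>0) = subst (_∈ ρs) (trans ρᵢ≡ (cong (walk a) l≡k)) (∈-lookup i)
            where
              e = a ⊕ₙ l
              no-entry-at-exit : ∀ j → ¬ EntersAt (lookup ρs j) e
              no-entry-at-exit j (l′ , ρⱼ≡ , e⊕l′≢e) = members-compatible C (∈-lookup j) (∈-lookup i)
                (subst₂ (Incompatible n) (sym ρⱼ≡) (sym ρᵢ≡) (junction-incompatible a l l′ e≢a e⊕l′≢e))
              exit-deficit : sumℚ (term e) ℚ.< 0ℚ
              exit-deficit = sumℚ-neg (term e) (λ j → nonpositive-term (lookup ρs j) e (lam≥0 j) (no-entry-at-exit j)) i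
                (subst (λ ρ → lam i ℚ.* ∂ (indicator n ρ) e ℚ.< 0ℚ) (sym ρᵢ≡) (negative-term lamᵢ>0 e≢a))
              l<n : l < n
              l<n = allowed-walk<n (subst Allowed ρᵢ≡ (All.lookup (allowed C) (∈-lookup i)))
              l≡k : l ≡ k
              l≡k = ⊕-cancelˡ a l<n k<n (χ-diff-neg (e Fin.≟ a) (e Fin.≟ a ⊕ₙ k) (subst (ℚ._< 0ℚ) (sym (balance e)) exit-deficit))

  InRedCone-member : ∀ {ρs ρ} → ρ ∈ ρs → InRedCone n ρs (indicator n ρ)
  InRedCone-member {ρs} {ρ} ρ∈ = InRedCone-add-member ρ∈ (ℚ.<⇒≤ (ℚ.positive⁻¹ 1ℚ)) (InRedCone-zero ρs)
    (λ e → sym (trans (ℚ.+-identityʳ (1ℚ ℚ.* indicator n ρ e)) (ℚ.*-identityˡ (indicator n ρ e))))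

  redConeSub⇒raySub : ∀ C C′ → RedConeSub n C C′ → RaySub n (raysOf C) (raysOf C′)
  redConeSub⇒raySub C C′ C⊆C′ D D∈ = ray (∈-raysOf⁻ C D∈)
    where
      ray : DiagonalOfRoute C D → ∃ λ D′ → D′ ∈ raysOf C′ × SameRay n D D′
      ray (a , k , ρ∈ , proper , D≡) =
        Product.map₂ (Product.map₂ (λ D′≡ → inj₁ (SameSeg-reflexive (trans D≡ (sym D′≡)))))
          (∈-raysOf⁺ C′ (redCone-walk-member C′ proper (C⊆C′ _ (InRedCone-member ρ∈))) proper)

  nontrivial-proper : ∀ {a k} → Allowed (walk a (suc k)) → Proper a (suc k)
  nontrivial-proper {a} allowed = toℕ<n a , z<s , allowed-walk<n allowed

  raySub⇒covered : ∀ C C′ → RaySub n (raysOf C) (raysOf C′) → ∀ {ρ} → ρ ∈ routes C → Exceptional n ρ ⊎ ρ ∈ routes C′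
  raySub⇒covered C C′ sub {cycle}          _  = inj₁ cycle-exceptional
  raySub⇒covered C C′ sub {walk a zero}    _  = inj₁ (trivial-exceptional a)
  raySub⇒covered C C′ sub {walk a (suc k)} ρ∈ = inj₂ (matching (∈-raysOf⁺ C ρ∈ proper))
    where
      proper = nontrivial-proper (All.lookup (allowed C) ρ∈)
      matching : ∃ (λ D → D ∈ raysOf C × proj₁ D ≡ chord (toℕ a) (suc k)) → walk a (suc k) ∈ routes C′
      matching (D , D∈ , D≡) = same-route (sub D D∈)
        where
          same-route : ∃ (λ D′ → D′ ∈ raysOf C′ × SameRay n D D′) → walk a (suc k) ∈ routes C′
          same-route (D′ , D′∈ , D~D′) = same-walk (∈-raysOf⁻ C′ D′∈)
            where
              same-walk : DiagonalOfRoute C′ D′ → walk a (suc k) ∈ routes C′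
              same-walk (c , l , σ∈ , proper′ , D′≡) =
                subst (_∈ routes C′) (sym (cong₂ walk (toℕ-injective (proj₁ same)) (proj₂ same))) σ∈
                where same = chord-ray-injective proper proper′ (subst₂ (InRaySeg n) D≡ D′≡ D~D′)

  raySub⇒redConeSub : ∀ C C′ → RaySub n (raysOf C) (raysOf C′) → RedConeSub n C C′
  raySub⇒redConeSub C C′ sub = InRedCone-mono (routes C) (raySub⇒covered C C′ sub)

proposition7p6 : (n : ℕ) .{{_ : NonZero n}} →
    ∃ λ (F : CompatSet n → List (Diag n)) →
      (∀ C → NoncrossingRays n (F C)) ×
      (∀ C C' → RedConeSub n C C' ⇔ RaySub n (F C) (F C')) ×
      (∀ S → NoncrossingRays n S → ∃ λ C → RaySub n S (F C) × RaySub n (F C) S)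
proposition7p6 n =
  raysOf n ,
  raysOf-noncrossing n ,
  (λ C C′ → mk⇔ (redConeSub⇒raySub n C C′) (raySub⇒redConeSub n C C′)) ,
  λ S noncrossing → compatSetOf n noncrossing , S⊆raysOf-compatSetOf n noncrossing , raysOf-compatSetOf⊆S n noncrossing
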